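{- Let $k$ be a positive integer, let $G_1,G_2\in\Delta_{k-1}$, and let $G_3$ be a graph of linear rank-width at most $k-1$. Then every delta composition of $G_1$, $G_2$ and $G_3$ has linear rank-width exactly $k$.
   Context: Graphs are finite and simple. For $X\subseteq V(G)$, $\mathrm{cutrk}_G(X)$ is the binary rank of the submatrix of the adjacency matrix with rows $X$ and columns $V(G)\setminus X$. A linear layout of $G$ is an ordering $(v_1,\dots,v_n)$ of $V(G)$ with width $\max_i\mathrm{cutrk}_G(\{v_1,\dots,v_i\})$ (or $0$ if $n\le 1$). The linear rank-width is the minimum width of a linear layout. A delta composition of graphs $G_1,G_2,G_3$ is obtained from their disjoint union by choosing $v_i\in V(G_i)$ for $i=1,2,3$ and adding the triangle $v_1v_2v_3$. $\Delta_0=\{K_2\}$, and for $i\ge1$, $\Delta_i$ is the set of delta compositions of three (not necessarily distinct) graphs in $\Delta_{i-1}$, up to isomorphism. -}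

module Defs where

open import Data.Nat using (ℕ; zero; suc; _≤_)
open import Data.Nat.Properties using (_<?_)
open import Data.Bool using (Bool; true; false; _∧_; _xor_; not)
open import Data.Bool.Properties using (∧-comm)
open import Data.Fin using (Fin; toℕ; splitAt; _≟_; zero; suc)
open import Data.Fin.Subset using (Subset; _∈_; _⊆_; ∁; ∣_∣; Nonempty)
open import Data.Fin.Permutation using (Permutation; Permutation′; _⟨$⟩ʳ_; _⟨$⟩ˡ_)
open import Data.Vec using (Vec; lookup; tabulate; allFin; foldr′)
open import Data.Sum using (_⊎_; inj₁; inj₂)
open import Data.Product using (Σ; ∃; _×_; _,_)
open import Relation.Nullary using (¬_)
open import Relation.Nullary.Decidable using (⌊_⌋)
open import Relation.Binary.PropositionalEquality using (_≡_; refl)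

record Graph : Set where
  field
    n      : ℕ
    adj    : Fin n → Fin n → Bool
    sym    : ∀ i j → adj i j ≡ adj j i
    irrefl : ∀ i → adj i i ≡ false
open Graph public

_≅_ : Graph → Graph → Set
G ≅ H = Σ (Permutation (n G) (n H)) λ π →
          ∀ i j → adj H (π ⟨$⟩ʳ i) (π ⟨$⟩ʳ j) ≡ adj G i j

K2 : Graph
K2 = record { n = 2 ; adj = a ; sym = s ; irrefl = r }
  where
  a : Fin 2 → Fin 2 → Bool
  a i j = not ⌊ i ≟ j ⌋
  s : ∀ i j → a i j ≡ a j i
  s zero zero = refl
  s zero (suc zero) = refl
  s (suc zero) zero = refl
  s (suc zero) (suc zero) = refl
  r : ∀ i → a i i ≡ false
  r zero = refl
  r (suc zero) = refl

-- Over GF(2): the j-th entry of the sum of the rows indexed by T.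
rowSum : (G : Graph) → Subset (n G) → Fin (n G) → Bool
rowSum G T j = foldr′ (λ i acc → (lookup T i ∧ adj G i j) xor acc) false (allFin (n G))

-- S is a set of rows (S ⊆ X) of the matrix A_G[X, V∖X] that is linearly
-- independent over GF(2): no nonempty subset of them sums to the zero vector.
Independent : (G : Graph) → Subset (n G) → Subset (n G) → Set
Independent G X S =
  S ⊆ X × (∀ T → T ⊆ S → Nonempty T →
             ∃ λ j → j ∈ ∁ X × rowSum G T j ≡ true)

-- cutrk_G(X) ≤ r : the binary rank (maximum number of linearly independent
-- rows) of A_G[X, V∖X] is at most r.
CutRkLe : (G : Graph) → Subset (n G) → ℕ → Set
CutRkLe G X r = ∀ S → Independent G X S → ∣ S ∣ ≤ r

-- A linear layout is a permutation π : positions → vertices; v_p = π ⟨$⟩ʳ p.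
Layout : Graph → Set
Layout G = Permutation′ (n G)

prefix : (G : Graph) → Layout G → ℕ → Subset (n G)
prefix G π i = tabulate λ v → ⌊ toℕ (π ⟨$⟩ˡ v) <? i ⌋

-- width of the layout ≤ r  (prefixes with i = 0 or i = n have cut-rank 0,
-- so including them is harmless; this also covers the n ≤ 1 convention).
WidthLe : (G : Graph) → Layout G → ℕ → Set
WidthLe G π r = ∀ i → CutRkLe G (prefix G π i) r

LrwLe : Graph → ℕ → Set
LrwLe G r = ∃ λ (π : Layout G) → WidthLe G π r

LrwEq : Graph → ℕ → Set
LrwEq G r = LrwLe G r × (∀ s → LrwLe G s → r ≤ s)

part : ∀ {a b c} → Fin (a Data.Nat.+ (b Data.Nat.+ c)) → Fin a ⊎ (Fin b ⊎ Fin c)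
part {a} {b} x with splitAt a x
... | inj₁ u = inj₁ u
... | inj₂ y = inj₂ (splitAt b y)

module _ (G₁ G₂ G₃ : Graph) (v₁ : Fin (n G₁)) (v₂ : Fin (n G₂)) (v₃ : Fin (n G₃)) where

  private
    V = Fin (n G₁) ⊎ (Fin (n G₂) ⊎ Fin (n G₃))

    isT : V → Bool
    isT (inj₁ a) = ⌊ a ≟ v₁ ⌋
    isT (inj₂ (inj₁ b)) = ⌊ b ≟ v₂ ⌋
    isT (inj₂ (inj₂ c)) = ⌊ c ≟ v₃ ⌋

    adjV : V → V → Bool
    adjV (inj₁ a) (inj₁ b) = adj G₁ a b
    adjV (inj₂ (inj₁ a)) (inj₂ (inj₁ b)) = adj G₂ a b
    adjV (inj₂ (inj₂ a)) (inj₂ (inj₂ b)) = adj G₃ a b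
    adjV (inj₁ a) (inj₂ y) = isT (inj₁ a) ∧ isT (inj₂ y)
    adjV (inj₂ (inj₁ a)) (inj₁ b) = isT (inj₂ (inj₁ a)) ∧ isT (inj₁ b)
    adjV (inj₂ (inj₁ a)) (inj₂ (inj₂ b)) = isT (inj₂ (inj₁ a)) ∧ isT (inj₂ (inj₂ b))
    adjV (inj₂ (inj₂ a)) (inj₁ b) = isT (inj₂ (inj₂ a)) ∧ isT (inj₁ b)
    adjV (inj₂ (inj₂ a)) (inj₂ (inj₁ b)) = isT (inj₂ (inj₂ a)) ∧ isT (inj₂ (inj₁ b))

    symV : ∀ x y → adjV x y ≡ adjV y x
    symV (inj₁ a) (inj₁ b) = sym G₁ a b
    symV (inj₂ (inj₁ a)) (inj₂ (inj₁ b)) = sym G₂ a b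
    symV (inj₂ (inj₂ a)) (inj₂ (inj₂ b)) = sym G₃ a b
    symV (inj₁ a) (inj₂ (inj₁ b)) = ∧-comm (isT (inj₁ a)) _
    symV (inj₁ a) (inj₂ (inj₂ b)) = ∧-comm (isT (inj₁ a)) _
    symV (inj₂ (inj₁ a)) (inj₁ b) = ∧-comm (isT (inj₂ (inj₁ a))) _
    symV (inj₂ (inj₁ a)) (inj₂ (inj₂ b)) = ∧-comm (isT (inj₂ (inj₁ a))) _
    symV (inj₂ (inj₂ a)) (inj₁ b) = ∧-comm (isT (inj₂ (inj₂ a))) _
    symV (inj₂ (inj₂ a)) (inj₂ (inj₁ b)) = ∧-comm (isT (inj₂ (inj₂ a))) _

    irrV : ∀ x → adjV x x ≡ false
    irrV (inj₁ a) = irrefl G₁ a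
    irrV (inj₂ (inj₁ a)) = irrefl G₂ a
    irrV (inj₂ (inj₂ a)) = irrefl G₃ a

  deltaComp : Graph
  deltaComp = record
    { n = n G₁ Data.Nat.+ (n G₂ Data.Nat.+ n G₃)
    ; adj = λ x y → adjV (part x) (part y)
    ; sym = λ x y → symV (part x) (part y)
    ; irrefl = λ x → irrV (part x)
    }

data InDelta : ℕ → Graph → Set where
  base : ∀ {G} → G ≅ K2 → InDelta zero G
  step : ∀ {i G} (G₁ G₂ G₃ : Graph)
         (v₁ : Fin (n G₁)) (v₂ : Fin (n G₂)) (v₃ : Fin (n G₃)) →
         InDelta i G₁ → InDelta i G₂ → InDelta i G₃ →
         G ≅ deltaComp G₁ G₂ G₃ v₁ v₂ v₃ → InDelta (suc i) G

-- Cut-ranks are handled through factorizations: a cut matrix that factors over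
-- GF(2) through dimension r has rank at most r (by Gaussian elimination), and a
-- greedily chosen row basis gives such a factorization.
--
-- Lower bound: in every vertex ordering of a graph of Δ_k some cut has rank at
-- least k + 1. For a delta composition take, among the cuts forced in its three
-- parts, the median one; it carries k + 1 independent rows of its part, and one
-- more comes from an edge crossing it, either inside one of the other two parts
-- or on the triangle. Since G₁ is an induced subgraph, lrw ≥ k + 1.
--
-- Upper bound: every graph of Δ_k has, for each vertex v, a layout of width
-- k + 1 that keeps width k + 1 when a pendant vertex at v is appended at the
-- end. Concatenating such layouts of G₁ and of G₂ (reversed) around an optimal
-- layout of G₃ gives width k + 1.

module Submission where

open import Algebra.Bundles using (CommutativeRing)
open import Data.Bool using (Bool; true; false; not; _∧_; _∨_; _xor_) renaming (_≟_ to _≟ᵇ_)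
open import Data.Bool.Properties
  using (xor-∧-commutativeRing; xor-identityʳ; xor-same; ∧-comm; ∧-assoc; ∧-zeroʳ; ∧-identityʳ;
         ∧-distribˡ-xor; ∧-distribʳ-xor; ∧-conicalˡ; ¬-not; not-injective)
open import Data.Empty using (⊥-elim)
open import Data.Fin using (Fin; zero; suc; toℕ; _≟_; splitAt; _↑ˡ_; _↑ʳ_)
import Data.Fin.Permutation as Perm
open import Data.Fin.Permutation
  using (Permutation; Permutation′; permutation; _⟨$⟩ʳ_; _⟨$⟩ˡ_; inverseʳ; inverseˡ;
         _∘ₚ_; flip; cast-id; reverse; ↔⇒≡)
open import Data.Fin.Properties
  using (any?; all?; ¬∀⟶∃¬; suc-injective; 0≢1+n; toℕ-injective; toℕ<n; toℕ-↑ˡ; toℕ-↑ʳ; toℕ-cast;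
         opposite-prop; splitAt-↑ˡ; splitAt-↑ʳ; join-splitAt)
open import Data.Fin.Subset
  using (Subset; _∈_; _∉_; _⊆_; ∁; ∣_∣; Nonempty; Empty; ⁅_⁆; _∪_; inside; outside)
  renaming (⊥ to ∅)
open import Data.Fin.Subset.Properties
  using (Empty-unique; ∣⊥∣≡0; x∈⁅x⁆; x∈⁅y⁆⇒x≡y; _∈?_; x∈p∪q⁺; x∈p∪q⁻; ∉⊥; ∪-identityʳ; anySubset?)
open import Data.List using (List; []; _∷_) renaming (allFin to allFinₗ)
open import Data.List.Membership.Propositional using () renaming (_∈_ to _∈ₗ_)
open import Data.List.Membership.Propositional.Properties using (∈-allFin)
open import Data.List.Relation.Unary.Any using (here; there)
open import Data.Nat using (ℕ; zero; suc; _+_; _∸_; _≤_; _<_; s≤s; _<?_; _≤?_)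
open import Data.Nat.Properties
  using (≤-refl; ≤-reflexive; ≤-trans; ≤-pred; n≤1+n; m≤n⇒m≤1+n; m≤m+n; m≤n+m∸n; ≮⇒≥; ≤⇒≯; ≰⇒>;
         <⇒≤; <-cmp; <-irrefl; <-≤-trans; +-comm; +-suc; +-assoc; +-monoʳ-≤; +-monoʳ-<;
         m≤o∸n⇒m+n≤o; m+n≤o⇒m≤o∸n; m≤n⇒m∸n≡0; m∸n+n≡m; m+n∸m≡n; ∸-monoʳ-≤)
open import Data.Product using (Σ; ∃; _×_; _,_; proj₁; proj₂)
open import Data.Sum using (_⊎_; inj₁; inj₂; [_,_]′)
open import Data.Sum.Properties using (inj₁-injective)
open import Data.Unit using (⊤; tt)
open import Data.Vec using (Vec; []; _∷_; lookup; tabulate; map; foldr′; here; there)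
open import Data.Vec.Functional using () renaming (_∷_ to _∷ᶠ_)
open import Data.Vec.Properties using ([]=⇒lookup; lookup⇒[]=; lookup-map; lookup-zipWith; lookup∘tabulate)
open import Function using (_∘_; id; case_of_)
open import Function.Definitions using (Injective)
open import Relation.Binary using (tri<; tri≈; tri>)
open import Relation.Binary.PropositionalEquality
  using (_≡_; refl; sym; trans; cong; cong₂; subst; module ≡-Reasoning)
open import Relation.Nullary using (¬_; Dec; yes; no)
open import Relation.Nullary.Decidable
  using (⌊_⌋; ⌊⌋-map′; isYes≗does; dec-true; dec-false; _×-dec_; _→-dec_)

open import Defs hiding (sym)

open import Algebra.Properties.Semiring.Sum (CommutativeRing.semiring xor-∧-commutativeRing)
  using (sum; sum-cong-≗; ∑-distrib-+; *-distribˡ-sum; *-distribʳ-sum; sum-replicate-zero)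

-- Sums over GF(2)

true≢false : ¬ true ≡ false
true≢false ()

≟-refl : ∀ {m} (x : Fin m) → ⌊ x ≟ x ⌋ ≡ true
≟-refl x = trans (isYes≗does (x ≟ x)) (dec-true (x ≟ x) refl)

≢⇒≟-false : ∀ {m} {x y : Fin m} → ¬ x ≡ y → ⌊ x ≟ y ⌋ ≡ false
≢⇒≟-false {x = x} {y} x≢y = trans (isYes≗does (x ≟ y)) (dec-false (x ≟ y) x≢y)

≟-suc : ∀ {m} (x y : Fin m) → ⌊ suc x ≟ suc y ⌋ ≡ ⌊ x ≟ y ⌋
≟-suc x y = ⌊⌋-map′ _ _ (x ≟ y)

∑-select : ∀ {m} (x : Fin m) (f : Fin m → Bool) → sum (λ t → ⌊ t ≟ x ⌋ ∧ f t) ≡ f x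
∑-select {suc m} zero    f = trans (cong (f zero xor_) (sum-replicate-zero m)) (xor-identityʳ (f zero))
∑-select {suc m} (suc x) f =
  trans (sum-cong-≗ (λ t → cong (_∧ f (suc t)) (≟-suc t x))) (∑-select x (λ t → f (suc t)))

∑-zero : ∀ {m} (f : Fin m → Bool) → (∀ t → f t ≡ false) → sum f ≡ false
∑-zero {m} f f≡0 = trans (sum-cong-≗ f≡0) (sum-replicate-zero m)

foldr-xor-tabulate : ∀ {A : Set} m (h : Fin m → A) (f : A → Bool) →
                     foldr′ (λ a acc → f a xor acc) false (tabulate h) ≡ sum (f ∘ h)
foldr-xor-tabulate zero    h f = refl
foldr-xor-tabulate (suc m) h f = cong (f (h zero) xor_) (foldr-xor-tabulate m (h ∘ suc) f)

rowSum≡∑ : ∀ G T j → rowSum G T j ≡ sum (λ i → lookup T i ∧ adj G i j)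
rowSum≡∑ G T j = foldr-xor-tabulate (n G) id (λ i → lookup T i ∧ adj G i j)

∈⇒true : ∀ {m} {x : Fin m} {p : Subset m} → x ∈ p → lookup p x ≡ true
∈⇒true = []=⇒lookup

true⇒∈ : ∀ {m} {x : Fin m} {p : Subset m} → lookup p x ≡ true → x ∈ p
true⇒∈ {x = x} {p} = lookup⇒[]= x p

∉⇒false : ∀ {m} {x : Fin m} {p : Subset m} → x ∉ p → lookup p x ≡ false
∉⇒false {x = x} {p} x∉p with lookup p x in eq
... | true  = ⊥-elim (x∉p (true⇒∈ eq))
... | false = refl

lookup-⁅⁆ : ∀ {m} (x i : Fin m) → lookup ⁅ x ⁆ i ≡ ⌊ i ≟ x ⌋
lookup-⁅⁆ zero    zero    = refl
lookup-⁅⁆ zero    (suc i) = ∉⇒false (∉⊥ {x = i})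
lookup-⁅⁆ (suc x) zero    = refl
lookup-⁅⁆ (suc x) (suc i) = trans (lookup-⁅⁆ x i) (sym (≟-suc i x))

lookup-∁ : ∀ {m} (p : Subset m) i → lookup (∁ p) i ≡ not (lookup p i)
lookup-∁ p i = lookup-map i not p

lookup-∪ : ∀ {m} (p q : Subset m) i → lookup (p ∪ q) i ≡ lookup p i ∨ lookup q i
lookup-∪ p q i = lookup-zipWith _∨_ i p q

-- The library's p - x is defined through a local helper of _─_, which blocks
-- computing its cardinality; this structural removal computes.
remove : ∀ {m} → Subset m → Fin m → Subset m
remove (s ∷ p) zero    = outside ∷ p
remove (s ∷ p) (suc x) = s ∷ remove p x

lookup-remove : ∀ {m} (p : Subset m) x i → lookup (remove p x) i ≡ lookup p i ∧ not ⌊ i ≟ x ⌋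
lookup-remove (s ∷ p) zero    zero    = sym (∧-zeroʳ s)
lookup-remove (s ∷ p) zero    (suc i) = sym (∧-identityʳ _)
lookup-remove (s ∷ p) (suc x) zero    = sym (∧-identityʳ s)
lookup-remove (s ∷ p) (suc x) (suc i) =
  trans (lookup-remove p x i) (cong (λ b → lookup p i ∧ not b) (sym (≟-suc i x)))

remove⊆ : ∀ {m} (p : Subset m) x → remove p x ⊆ p
remove⊆ p x {i} i∈ = true⇒∈ (∧-conicalˡ _ _ (trans (sym (lookup-remove p x i)) (∈⇒true i∈)))

x∉remove : ∀ {m} (p : Subset m) x → x ∉ remove p x
x∉remove p x x∈ =
  true≢false (trans (sym (∈⇒true x∈))
             (trans (lookup-remove p x x) (trans (cong (λ b → lookup p x ∧ not b) (≟-refl x)) (∧-zeroʳ _))))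

∣p∣≤1+∣remove∣ : ∀ {m} (p : Subset m) x → ∣ p ∣ ≤ suc ∣ remove p x ∣
∣p∣≤1+∣remove∣ (inside  ∷ p) zero    = ≤-refl
∣p∣≤1+∣remove∣ (outside ∷ p) zero    = n≤1+n _
∣p∣≤1+∣remove∣ (inside  ∷ p) (suc x) = s≤s (∣p∣≤1+∣remove∣ p x)
∣p∣≤1+∣remove∣ (outside ∷ p) (suc x) = ∣p∣≤1+∣remove∣ p x

-- Rank bounds from factorizations

∨-∧-disjoint : ∀ a b g → a ∧ b ≡ false → (a ∨ b) ∧ g ≡ (a ∧ g) xor (b ∧ g)
∨-∧-disjoint true  true  g ()
∨-∧-disjoint true  false g _ = sym (xor-identityʳ g)
∨-∧-disjoint false b     g _ = refl

∑-⁅⁆ : ∀ {m} (x : Fin m) (g : Fin m → Bool) → sum (λ i → lookup ⁅ x ⁆ i ∧ g i) ≡ g x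
∑-⁅⁆ x g = trans (sum-cong-≗ (λ i → cong (_∧ g i) (lookup-⁅⁆ x i))) (∑-select x g)

∑-∪⁅⁆ : ∀ {m} {x : Fin m} {T : Subset m} (g : Fin m → Bool) → x ∉ T →
        sum (λ i → lookup (T ∪ ⁅ x ⁆) i ∧ g i) ≡ sum (λ i → lookup T i ∧ g i) xor g x
∑-∪⁅⁆ {x = x} {T} g x∉T = begin
    sum (λ i → lookup (T ∪ ⁅ x ⁆) i ∧ g i)
  ≡⟨ sum-cong-≗ split ⟩
    sum (λ i → (lookup T i ∧ g i) xor (⌊ i ≟ x ⌋ ∧ g i))
  ≡⟨ ∑-distrib-+ (λ i → lookup T i ∧ g i) (λ i → ⌊ i ≟ x ⌋ ∧ g i) ⟩
    sum (λ i → lookup T i ∧ g i) xor sum (λ i → ⌊ i ≟ x ⌋ ∧ g i)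
  ≡⟨ cong (sum (λ i → lookup T i ∧ g i) xor_) (∑-select x g) ⟩
    sum (λ i → lookup T i ∧ g i) xor g x
  ∎
  where
  open ≡-Reasoning
  disjoint : ∀ i → lookup T i ∧ ⌊ i ≟ x ⌋ ≡ false
  disjoint i with i ≟ x
  ... | yes refl = cong (_∧ true) (∉⇒false x∉T)
  ... | no _     = ∧-zeroʳ _
  split : ∀ i → lookup (T ∪ ⁅ x ⁆) i ∧ g i ≡ (lookup T i ∧ g i) xor (⌊ i ≟ x ⌋ ∧ g i)
  split i = trans (cong (_∧ g i) (trans (lookup-∪ T ⁅ x ⁆ i) (cong (lookup T i ∨_) (lookup-⁅⁆ x i))))
                  (∨-∧-disjoint (lookup T i) ⌊ i ≟ x ⌋ (g i) (disjoint i))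

IndependentIn : ∀ {m} → (Fin m → Fin m → Bool) → Subset m → Subset m → Set
IndependentIn f X P =
  P ⊆ X × (∀ T → T ⊆ P → Nonempty T → ∃ λ j → j ∈ ∁ X × sum (λ i → lookup T i ∧ f i j) ≡ true)

FactorsOn : ∀ {m r} → (Fin m → Fin m → Bool) → Subset m → Subset m →
            (Fin m → Fin r → Bool) → (Fin r → Fin m → Bool) → Set
FactorsOn f X P C B = ∀ i j → i ∈ P → j ∈ ∁ X → f i j ≡ sum (λ t → C i t ∧ B t j)

pivot-cancel : ∀ c b r r₀ → ((c ∧ b) xor r) xor (c ∧ (b xor r₀)) ≡ r xor (c ∧ r₀)
pivot-cancel false b     r     r₀    = refl
pivot-cancel true  false false r₀    = refl
pivot-cancel true  false true  r₀    = refl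
pivot-cancel true  true  false false = refl
pivot-cancel true  true  false true  = refl
pivot-cancel true  true  true  false = refl
pivot-cancel true  true  true  true  = refl

-- One step of Gaussian elimination: the row x₀, whose coefficient on the first
-- factor is 1, is used as pivot to clear that coefficient from all other rows.
module Elimination {m r} (f : Fin m → Fin m → Bool) (X P : Subset m)
                   (C : Fin m → Fin (suc r) → Bool) (B : Fin (suc r) → Fin m → Bool)
                   (x₀ : Fin m) (x₀∈P : x₀ ∈ P) (C-x₀ : C x₀ zero ≡ true) where

  f′ : Fin m → Fin m → Bool
  f′ i j = f i j xor (C i zero ∧ f x₀ j)

  C′ : Fin m → Fin r → Bool
  C′ i t = C i (suc t) xor (C i zero ∧ C x₀ (suc t))

  B′ : Fin r → Fin m → Bool
  B′ t = B (suc t)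

  P′ : Subset m
  P′ = remove P x₀

  factorsOn′ : FactorsOn f X P C B → FactorsOn f′ X P′ C′ B′
  factorsOn′ fac i j i∈P′ j∉X = begin
      f i j xor (C i zero ∧ f x₀ j)
    ≡⟨ cong₂ (λ u v → u xor (C i zero ∧ v)) (fac i j (remove⊆ P x₀ i∈P′) j∉X) (fac x₀ j x₀∈P j∉X) ⟩
      ((C i zero ∧ B zero j) xor R i) xor (C i zero ∧ ((C x₀ zero ∧ B zero j) xor R x₀))
    ≡⟨ cong (λ u → ((C i zero ∧ B zero j) xor R i) xor (C i zero ∧ ((u ∧ B zero j) xor R x₀))) C-x₀ ⟩
      ((C i zero ∧ B zero j) xor R i) xor (C i zero ∧ (B zero j xor R x₀))
    ≡⟨ pivot-cancel (C i zero) (B zero j) (R i) (R x₀) ⟩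
      R i xor (C i zero ∧ R x₀)
    ≡⟨ cong (R i xor_) (*-distribˡ-sum (C i zero) (λ t → C x₀ (suc t) ∧ B′ t j)) ⟩
      R i xor sum (λ t → C i zero ∧ (C x₀ (suc t) ∧ B′ t j))
    ≡⟨ cong (R i xor_) (sum-cong-≗ (λ t → sym (∧-assoc (C i zero) (C x₀ (suc t)) (B′ t j)))) ⟩
      R i xor sum (λ t → (C i zero ∧ C x₀ (suc t)) ∧ B′ t j)
    ≡⟨ sym (∑-distrib-+ (λ t → C i (suc t) ∧ B′ t j) (λ t → (C i zero ∧ C x₀ (suc t)) ∧ B′ t j)) ⟩
      sum (λ t → (C i (suc t) ∧ B′ t j) xor ((C i zero ∧ C x₀ (suc t)) ∧ B′ t j))
    ≡⟨ sum-cong-≗ (λ t → sym (∧-distribʳ-xor (B′ t j) (C i (suc t)) _)) ⟩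
      sum (λ t → C′ i t ∧ B′ t j)
    ∎
    where
    open ≡-Reasoning
    R : Fin m → Bool
    R i = sum (λ t → C i (suc t) ∧ B′ t j)

  ∑-f′ : ∀ T j → sum (λ i → lookup T i ∧ f′ i j)
                 ≡ sum (λ i → lookup T i ∧ f i j) xor (sum (λ i → lookup T i ∧ C i zero) ∧ f x₀ j)
  ∑-f′ T j = begin
      sum (λ i → lookup T i ∧ f′ i j)
    ≡⟨ sum-cong-≗ (λ i → trans (∧-distribˡ-xor (lookup T i) _ _)
                                (cong ((lookup T i ∧ f i j) xor_) (sym (∧-assoc (lookup T i) _ _)))) ⟩
      sum (λ i → (lookup T i ∧ f i j) xor ((lookup T i ∧ C i zero) ∧ f x₀ j))
    ≡⟨ ∑-distrib-+ (λ i → lookup T i ∧ f i j) (λ i → (lookup T i ∧ C i zero) ∧ f x₀ j) ⟩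
      sum (λ i → lookup T i ∧ f i j) xor sum (λ i → (lookup T i ∧ C i zero) ∧ f x₀ j)
    ≡⟨ cong (sum (λ i → lookup T i ∧ f i j) xor_) (sym (*-distribʳ-sum (f x₀ j) (λ i → lookup T i ∧ C i zero))) ⟩
      sum (λ i → lookup T i ∧ f i j) xor (sum (λ i → lookup T i ∧ C i zero) ∧ f x₀ j)
    ∎
    where open ≡-Reasoning

  -- A combination T of rows of f′ is the combination T or T ∪ {x₀} of rows of f.
  independent′ : IndependentIn f X P → IndependentIn f′ X P′
  independent′ (P⊆X , ind) = P⊆X ∘ remove⊆ P x₀ , ind′
    where
    ind′ : ∀ T → T ⊆ P′ → Nonempty T → ∃ λ j → j ∈ ∁ X × sum (λ i → lookup T i ∧ f′ i j) ≡ true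
    ind′ T T⊆P′ T≠∅ with sum (λ i → lookup T i ∧ C i zero) in coef
    ... | false =
      let (j , j∉X , e) = ind T (remove⊆ P x₀ ∘ T⊆P′) T≠∅
      in j , j∉X , trans (∑-f′ T j) (trans (cong (λ b → sum (λ i → lookup T i ∧ f i j) xor (b ∧ f x₀ j)) coef)
                                          (trans (xor-identityʳ _) e))
    ... | true =
      let (j , j∉X , e) = ind (T ∪ ⁅ x₀ ⁆) T∪x₀⊆P (x₀ , x∈p∪q⁺ (inj₂ (x∈⁅x⁆ x₀)))
      in j , j∉X , trans (∑-f′ T j) (trans (cong (λ b → sum (λ i → lookup T i ∧ f i j) xor (b ∧ f x₀ j)) coef)
                                          (trans (sym (∑-∪⁅⁆ (λ i → f i j) x₀∉T)) e))
      where
      x₀∉T : x₀ ∉ T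
      x₀∉T = x∉remove P x₀ ∘ T⊆P′
      T∪x₀⊆P : T ∪ ⁅ x₀ ⁆ ⊆ P
      T∪x₀⊆P z∈ with x∈p∪q⁻ T ⁅ x₀ ⁆ z∈
      ... | inj₁ z∈T  = remove⊆ P x₀ (T⊆P′ z∈T)
      ... | inj₂ z∈x₀ = subst (_∈ P) (sym (x∈⁅y⁆⇒x≡y x₀ z∈x₀)) x₀∈P

independent≤dim : ∀ r {m} (f : Fin m → Fin m → Bool) (X P : Subset m)
                  (C : Fin m → Fin r → Bool) (B : Fin r → Fin m → Bool) →
                  IndependentIn f X P → FactorsOn f X P C B → ∣ P ∣ ≤ r
independent≤dim zero {m} f X P C B (_ , ind) fac =
  ≤-reflexive (trans (cong ∣_∣ (Empty-unique P-empty)) (∣⊥∣≡0 m))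
  where
  P-empty : Empty P
  P-empty (x , x∈P) =
    let (j , j∉X , e) = ind ⁅ x ⁆ (λ z∈ → subst (_∈ P) (sym (x∈⁅y⁆⇒x≡y x z∈)) x∈P) (x , x∈⁅x⁆ x)
    in true≢false (trans (sym (trans (sym (∑-⁅⁆ x (λ i → f i j))) e)) (fac x j x∈P j∉X))
independent≤dim (suc r) f X P C B indep fac with any? (λ i → (i ∈? P) ×-dec (C i zero ≟ᵇ true))
... | yes (x₀ , x₀∈P , C-x₀) =
  ≤-trans (∣p∣≤1+∣remove∣ P x₀) (s≤s (independent≤dim r f′ X P′ C′ B′ (independent′ indep) (factorsOn′ fac)))
  where open Elimination f X P C B x₀ x₀∈P C-x₀
... | no none =
  m≤n⇒m≤1+n (independent≤dim r f X P (λ i t → C i (suc t)) (λ t → B (suc t)) indep fac-tail)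
  where
  fac-tail : FactorsOn f X P (λ i t → C i (suc t)) (λ t → B (suc t))
  fac-tail i j i∈P j∉X with C i zero in C-i | fac i j i∈P j∉X
  ... | true  | _ = ⊥-elim (none (i , i∈P , C-i))
  ... | false | e = e

record FactorsThrough {V : Set} (M : V → V → Bool) (X : V → Bool) (r : ℕ) : Set where
  constructor factorization
  field
    dim     : ℕ
    dim≤r   : dim ≤ r
    left    : V → Fin dim → Bool
    right   : Fin dim → V → Bool
    factors : ∀ x y → X x ≡ true → X y ≡ false → M x y ≡ sum (λ t → left x t ∧ right t y)

factorsThrough⇒cutRkLe : ∀ G X r → FactorsThrough (adj G) (lookup X) r → CutRkLe G X r
factorsThrough⇒cutRkLe G X r (factorization m m≤r C B fac) P (P⊆X , ind) =
  ≤-trans (independent≤dim m (adj G) X P C B (P⊆X , ind′) fac′) m≤r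
  where
  ind′ : ∀ T → T ⊆ P → Nonempty T → ∃ λ j → j ∈ ∁ X × sum (λ i → lookup T i ∧ adj G i j) ≡ true
  ind′ T T⊆P T≠∅ = let (j , j∉X , e) = ind T T⊆P T≠∅ in j , j∉X , trans (sym (rowSum≡∑ G T j)) e
  fac′ : FactorsOn (adj G) X P C B
  fac′ i j i∈P j∉X = fac i j (∈⇒true (P⊆X i∈P)) (not-injective (trans (sym (lookup-∁ X j)) (∈⇒true j∉X)))

-- Independent families of rows

false⇒∈∁ : ∀ {m} {c : Fin m} (X : Subset m) → lookup X c ≡ false → c ∈ ∁ X
false⇒∈∁ {c = c} X e = true⇒∈ (trans (lookup-∁ X c) (cong not e))

Nonzero : ∀ {m} → (Fin m → Bool) → Set
Nonzero sel = ∃ λ t → sel t ≡ true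

IndependentRows : ∀ {V C : Set} {m} → (V → C → Bool) → (C → Set) → Vec V m → Set
IndependentRows row Col xs =
  ∀ sel → Nonzero sel → ∃ λ c → Col c × sum (λ t → sel t ∧ row (lookup xs t) c) ≡ true

module _ {V C : Set} (row : V → C → Bool) where

  independentRows-mono : ∀ {m} {Col Col′ : C → Set} {xs : Vec V m} → (∀ {c} → Col c → Col′ c) →
                         IndependentRows row Col xs → IndependentRows row Col′ xs
  independentRows-mono Col⊆Col′ ind sel sel≠0 = let (c , c∈ , e) = ind sel sel≠0 in c , Col⊆Col′ c∈ , e

  ∷-independentRows : ∀ {m} {Col : C → Set} {xs : Vec V m} {x : V} → IndependentRows row Col xs →
    (∀ sel → ∃ λ c → Col c × row x c xor sum (λ t → sel t ∧ row (lookup xs t) c) ≡ true) →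
    IndependentRows row Col (x ∷ xs)
  ∷-independentRows ind new sel (t₀ , sel-t₀) with sel zero in sel-0
  ... | true  = new (λ t → sel (suc t))
  ... | false with t₀
  ...   | zero   = ⊥-elim (true≢false (trans (sym sel-t₀) sel-0))
  ...   | suc t₁ = ind (λ t → sel (suc t)) (t₁ , sel-t₀)

  ∷-independent-freshColumn : ∀ {m} {Col : C → Set} {xs : Vec V m} {x : V} (y : C) → Col y →
    row x y ≡ true → (∀ t → row (lookup xs t) y ≡ false) →
    IndependentRows row Col xs → IndependentRows row Col (x ∷ xs)
  ∷-independent-freshColumn {Col = Col} {xs} {x} y y∈ x-y xs-y ind = ∷-independentRows {Col = Col} {xs} {x} ind λ sel →
    y , y∈ , cong₂ _xor_ x-y (∑-zero _ (λ t → trans (cong (sel t ∧_) (xs-y t)) (∧-zeroʳ (sel t))))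

  ∷-independent-disjointSupport : ∀ {m} {Col Col′ : C → Set} {xs : Vec V m} {x : V} (y : C) → Col y →
    row x y ≡ true → (∀ {c} → Col′ c → Col c) → (∀ c → Col′ c → row x c ≡ false) →
    IndependentRows row Col′ xs → IndependentRows row Col (x ∷ xs)
  ∷-independent-disjointSupport {Col = Col} {Col′} {xs} {x} y y∈ x-y Col′⊆Col x-Col′ ind =
    ∷-independentRows {Col = Col} {xs} {x} (independentRows-mono {Col = Col′} {Col} {xs} Col′⊆Col ind) new
    where
    new : ∀ sel → ∃ λ c → Col c × row x c xor sum (λ t → sel t ∧ row (lookup xs t) c) ≡ true
    new sel with any? (λ t → sel t ≟ᵇ true)
    ... | yes sel≠0 =
      let (c , c∈ , e) = ind sel sel≠0
      in c , Col′⊆Col c∈ , trans (cong (_xor sum (λ t → sel t ∧ row (lookup xs t) c)) (x-Col′ c c∈)) e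
    ... | no  sel≡0 = y , y∈ , cong₂ _xor_ x-y (∑-zero _ zero-term)
      where
      zero-term : ∀ t → sel t ∧ row (lookup xs t) y ≡ false
      zero-term t with sel t in e
      ... | true  = ⊥-elim (sel≡0 (t , e))
      ... | false = refl

setOf : ∀ {k m} → Vec (Fin k) m → Subset k
setOf []       = ∅
setOf (x ∷ xs) = setOf xs ∪ ⁅ x ⁆

∈setOf⁻ : ∀ {k m} (xs : Vec (Fin k) m) {z} → z ∈ setOf xs → ∃ λ t → lookup xs t ≡ z
∈setOf⁻ []       z∈ = ⊥-elim (∉⊥ z∈)
∈setOf⁻ (x ∷ xs) z∈ with x∈p∪q⁻ (setOf xs) ⁅ x ⁆ z∈
... | inj₁ z∈xs = let (t , e) = ∈setOf⁻ xs z∈xs in suc t , e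
... | inj₂ z∈x  = zero , sym (x∈⁅y⁆⇒x≡y x z∈x)

∣p∪⁅x⁆∣ : ∀ {k} (p : Subset k) (x : Fin k) → x ∉ p → ∣ p ∪ ⁅ x ⁆ ∣ ≡ suc ∣ p ∣
∣p∪⁅x⁆∣ (inside  ∷ p) zero    x∉p = ⊥-elim (x∉p here)
∣p∪⁅x⁆∣ (outside ∷ p) zero    x∉p = cong (suc ∘ ∣_∣) (∪-identityʳ p)
∣p∪⁅x⁆∣ (inside  ∷ p) (suc x) x∉p = cong suc (∣p∪⁅x⁆∣ p x (x∉p ∘ there))
∣p∪⁅x⁆∣ (outside ∷ p) (suc x) x∉p = ∣p∪⁅x⁆∣ p x (x∉p ∘ there)

∣setOf∣ : ∀ {k m} (xs : Vec (Fin k) m) → Injective _≡_ _≡_ (lookup xs) → ∣ setOf xs ∣ ≡ m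
∣setOf∣ {k} []       _   = ∣⊥∣≡0 k
∣setOf∣     (x ∷ xs) inj = trans (∣p∪⁅x⁆∣ (setOf xs) x x∉xs) (cong suc (∣setOf∣ xs (suc-injective ∘ inj)))
  where
  x∉xs : x ∉ setOf xs
  x∉xs x∈xs with ∈setOf⁻ xs x∈xs
  ... | t , e with inj {zero} {suc t} (sym e)
  ...   | ()

∑-select₂ : ∀ {m} (t t′ : Fin m) (f : Fin m → Bool) →
            sum (λ u → (⌊ u ≟ t ⌋ xor ⌊ u ≟ t′ ⌋) ∧ f u) ≡ f t xor f t′
∑-select₂ t t′ f =
  trans (sum-cong-≗ (λ u → ∧-distribʳ-xor (f u) ⌊ u ≟ t ⌋ ⌊ u ≟ t′ ⌋))
        (trans (∑-distrib-+ (λ u → ⌊ u ≟ t ⌋ ∧ f u) (λ u → ⌊ u ≟ t′ ⌋ ∧ f u))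
               (cong₂ _xor_ (∑-select t f) (∑-select t′ f)))

-- Two equal rows t ≠ t′ would make the combination t + t′ vanish.
independentRows⇒injective : ∀ {C : Set} {k m} (row : Fin k → C → Bool) {Col : C → Set} (xs : Vec (Fin k) m) →
                            IndependentRows row Col xs → Injective _≡_ _≡_ (lookup xs)
independentRows⇒injective row xs ind {t} {t′} e with t ≟ t′
... | yes t≡t′ = t≡t′
... | no  t≢t′ =
  let (c , _ , h) = ind (λ u → ⌊ u ≟ t ⌋ xor ⌊ u ≟ t′ ⌋)
                        (t , trans (cong (_xor ⌊ t ≟ t′ ⌋) (≟-refl t)) (cong not (≢⇒≟-false t≢t′)))
  in ⊥-elim (true≢false (trans (sym h) (trans (∑-select₂ t t′ (λ u → row (lookup xs u) c))
                                              (trans (cong (λ z → row z c xor row (lookup xs t′) c) e)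
                                                     (xor-same (row (lookup xs t′) c))))))

∑-reindex : ∀ {k m} (xs : Vec (Fin k) m) → Injective _≡_ _≡_ (lookup xs) → (p : Fin k → Bool) →
            (∀ i → p i ≡ true → ∃ λ t → lookup xs t ≡ i) → (f : Fin k → Bool) →
            sum (λ i → p i ∧ f i) ≡ sum (λ t → p (lookup xs t) ∧ f (lookup xs t))
∑-reindex [] _ p p⊆xs f = ∑-zero (λ i → p i ∧ f i) p∧f≡0
  where
  p∧f≡0 : ∀ i → p i ∧ f i ≡ false
  p∧f≡0 i with p i in e
  ... | false = refl
  ... | true with p⊆xs i e
  ...   | () , _
∑-reindex {k} (x ∷ xs) inj p p⊆xs f =
  trans (sum-cong-≗ split)
        (trans (∑-distrib-+ (λ i → ⌊ i ≟ x ⌋ ∧ (p i ∧ f i)) (λ i → p′ i ∧ f i))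
               (cong₂ _xor_ (∑-select x (λ i → p i ∧ f i))
                            (trans (∑-reindex xs (suc-injective ∘ inj) p′ p′⊆xs f) (sum-cong-≗ p′-xs))))
  where
  p′ : Fin k → Bool
  p′ i = p i ∧ not ⌊ i ≟ x ⌋
  split : ∀ i → p i ∧ f i ≡ (⌊ i ≟ x ⌋ ∧ (p i ∧ f i)) xor (p′ i ∧ f i)
  split i with ⌊ i ≟ x ⌋
  ... | true  rewrite ∧-zeroʳ (p i)     = sym (xor-identityʳ _)
  ... | false rewrite ∧-identityʳ (p i) = refl
  p′⊆xs : ∀ i → p′ i ≡ true → ∃ λ t → lookup xs t ≡ i
  p′⊆xs i e with p⊆xs i (∧-conicalˡ _ _ e)
  ... | suc t , e′   = t , e′
  ... | zero  , refl = ⊥-elim (true≢false (trans (sym e) (trans (cong (λ b → p x ∧ not b) (≟-refl x)) (∧-zeroʳ _))))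
  p′-xs : ∀ t → p′ (lookup xs t) ∧ f (lookup xs t) ≡ p (lookup xs t) ∧ f (lookup xs t)
  p′-xs t rewrite ≢⇒≟-false {x = lookup xs t} {x} (λ e → 0≢1+n (sym (inj {suc t} {zero} e)))
                | ∧-identityʳ (p (lookup xs t)) = refl

cutRkLe⇒independentRows≤ : ∀ G (X : Subset (n G)) r → CutRkLe G X r → ∀ {m} (xs : Vec (Fin (n G)) m) →
                           (∀ t → lookup xs t ∈ X) → IndependentRows (adj G) (_∈ ∁ X) xs → m ≤ r
cutRkLe⇒independentRows≤ G X r cut xs xs⊆X ind =
  subst (_≤ r) (∣setOf∣ xs inj) (cut (setOf xs) (setOf⊆X , ind′))
  where
  inj = independentRows⇒injective (adj G) xs ind
  setOf⊆X : setOf xs ⊆ X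
  setOf⊆X z∈ with ∈setOf⁻ xs z∈
  ... | t , refl = xs⊆X t
  ind′ : ∀ T → T ⊆ setOf xs → Nonempty T → ∃ λ j → j ∈ ∁ X × rowSum G T j ≡ true
  ind′ T T⊆ (z , z∈T) =
    let (t₀ , e₀) = ∈setOf⁻ xs (T⊆ z∈T)
        (c , c∉X , h) = ind (λ t → lookup T (lookup xs t)) (t₀ , trans (cong (lookup T) e₀) (∈⇒true z∈T))
    in c , c∉X , trans (rowSum≡∑ G T c)
                       (trans (∑-reindex xs inj (lookup T) (λ i e → ∈setOf⁻ xs (T⊆ (true⇒∈ e))) (λ i → adj G i c)) h)

≢⇒xor-true : ∀ {a b} → ¬ a ≡ b → a xor b ≡ true
≢⇒xor-true {false} {false} a≢b = ⊥-elim (a≢b refl)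
≢⇒xor-true {false} {true}  _   = refl
≢⇒xor-true {true}  {false} _   = refl
≢⇒xor-true {true}  {true}  a≢b = ⊥-elim (a≢b refl)

module BasisExtraction (G : Graph) (X : Subset (n G)) where

  Spans : ∀ {m} → Vec (Fin (n G)) m → (Fin m → Bool) → Fin (n G) → Set
  Spans xs coef x = ∀ c → c ∈ ∁ X → adj G x c ≡ sum (λ t → coef t ∧ adj G (lookup xs t) c)

  spans? : ∀ {m} (xs : Vec (Fin (n G)) m) coef x → Dec (Spans xs (lookup coef) x)
  spans? xs coef x = all? (λ c → (c ∈? ∁ X) →-dec (adj G x c ≟ᵇ _))

  record Basis (L : List (Fin (n G))) : Set where
    field
      dim         : ℕ
      rows        : Vec (Fin (n G)) dim
      independent : IndependentRows (adj G) (_∈ ∁ X) rows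
      rows⊆X      : ∀ t → lookup rows t ∈ X
      spanning    : ∀ x → x ∈ₗ L → Σ (Fin dim → Bool) λ coef → x ∈ X → Spans rows coef x

  open Basis

  keep : ∀ {L} x (B : Basis L) → Σ (Fin (dim B) → Bool) (λ coef → x ∈ X → Spans (rows B) coef x) → Basis (x ∷ L)
  keep x B x-spanned = record
    { dim         = dim B
    ; rows        = rows B
    ; independent = independent B
    ; rows⊆X      = rows⊆X B
    ; spanning    = λ { _ (here refl) → x-spanned ; z (there z∈L) → spanning B z z∈L }
    }

  extend : ∀ {L} x (B : Basis L) → x ∈ X → ¬ (∃ λ coef → Spans (rows B) (lookup coef) x) → Basis (x ∷ L)
  extend x B x∈X x-free = record
    { dim         = suc (dim B)
    ; rows        = x ∷ rows B
    ; independent = ∷-independentRows (adj G) {xs = rows B} {x} (independent B) new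
    ; rows⊆X      = λ { zero → x∈X ; (suc t) → rows⊆X B t }
    ; spanning    = λ { _ (here refl) → (λ { zero → true ; (suc t) → false }) , λ _ c _ → x-itself c
                      ; z (there z∈L) → let (coef , sp) = spanning B z z∈L
                                        in (λ { zero → false ; (suc t) → coef t }) , sp }
    }
    where
    x-itself : ∀ c → adj G x c ≡ adj G x c xor sum (λ (t : Fin (dim B)) → false)
    x-itself c = sym (trans (cong (adj G x c xor_) (sum-replicate-zero (dim B))) (xor-identityʳ _))
    new : ∀ sel → ∃ λ c → c ∈ ∁ X × adj G x c xor sum (λ t → sel t ∧ adj G (lookup (rows B) t) c) ≡ true
    new sel with ¬∀⟶∃¬ (n G) _ (λ c → (c ∈? ∁ X) →-dec (adj G x c ≟ᵇ _)) sel-fails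
      where
      sel-fails : ¬ Spans (rows B) sel x
      sel-fails sp = x-free (tabulate sel , λ c c∉X →
        trans (sp c c∉X) (sum-cong-≗ (λ t → cong (_∧ adj G (lookup (rows B) t) c) (sym (lookup∘tabulate sel t)))))
    ... | c , ¬sp-c with c ∈? ∁ X
    ...   | no  c∉∁X = ⊥-elim (¬sp-c (⊥-elim ∘ c∉∁X))
    ...   | yes c∉X = c , c∉X , ≢⇒xor-true (¬sp-c ∘ λ e _ → e)

  basis : ∀ L → Basis L
  basis []      = record { dim = 0 ; rows = [] ; independent = λ { _ (() , _) } ; rows⊆X = λ () ; spanning = λ _ () }
  basis (x ∷ L) with basis L | x ∈? X
  ... | B | no  x∉X = keep x B ((λ _ → false) , ⊥-elim ∘ x∉X)
  ... | B | yes x∈X with anySubset? (λ coef → spans? (rows B) coef x)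
  ...   | yes (coef , sp) = keep x B (lookup coef , λ _ → sp)
  ...   | no  x-free      = extend x B x∈X x-free

cutRkLe⇒factorsThrough : ∀ G (X : Subset (n G)) r → CutRkLe G X r → FactorsThrough (adj G) (lookup X) r
cutRkLe⇒factorsThrough G X r cut = factorization
  dim (cutRkLe⇒independentRows≤ G X r cut rows rows⊆X independent)
  (λ x → proj₁ (spanning x (∈-allFin x))) (λ t → adj G (lookup rows t))
  (λ x y x∈X y∉X → proj₂ (spanning x (∈-allFin x)) (true⇒∈ x∈X) y (false⇒∈∁ X y∉X))
  where
  open BasisExtraction G X
  open Basis (basis (allFinₗ (n G)))

-- The vertex set of a delta composition

join₃ : ∀ {a b c} → Fin a ⊎ (Fin b ⊎ Fin c) → Fin (a + (b + c))
join₃ {a} {b} {c} (inj₁ x)        = x ↑ˡ (b + c)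
join₃ {a} {b} {c} (inj₂ (inj₁ y)) = a ↑ʳ (y ↑ˡ c)
join₃ {a} {b} {c} (inj₂ (inj₂ z)) = a ↑ʳ (b ↑ʳ z)

part∘join₃ : ∀ {a b c} (v : Fin a ⊎ (Fin b ⊎ Fin c)) → part {a} {b} {c} (join₃ v) ≡ v
part∘join₃ {a} {b} {c} (inj₁ x)        rewrite splitAt-↑ˡ a x (b + c) = refl
part∘join₃ {a} {b} {c} (inj₂ (inj₁ y)) rewrite splitAt-↑ʳ a (b + c) (y ↑ˡ c) | splitAt-↑ˡ b y c = refl
part∘join₃ {a} {b} {c} (inj₂ (inj₂ z)) rewrite splitAt-↑ʳ a (b + c) (b ↑ʳ z) | splitAt-↑ʳ b c z = refl

join₃∘part : ∀ {a b c} (x : Fin (a + (b + c))) → join₃ (part {a} {b} {c} x) ≡ x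
join₃∘part {a} {b} {c} x with splitAt a x in eq
... | inj₁ _ = trans (cong [ _↑ˡ (b + c) , a ↑ʳ_ ]′ (sym eq)) (join-splitAt a (b + c) x)
... | inj₂ y with splitAt b y in eq′
...   | inj₁ _ = trans (cong (a ↑ʳ_) (trans (cong [ _↑ˡ c , b ↑ʳ_ ]′ (sym eq′)) (join-splitAt b c y)))
                       (trans (cong [ _↑ˡ (b + c) , a ↑ʳ_ ]′ (sym eq)) (join-splitAt a (b + c) x))
...   | inj₂ _ = trans (cong (a ↑ʳ_) (trans (cong [ _↑ˡ c , b ↑ʳ_ ]′ (sym eq′)) (join-splitAt b c y)))
                       (trans (cong [ _↑ˡ (b + c) , a ↑ʳ_ ]′ (sym eq)) (join-splitAt a (b + c) x))

join₃-injective : ∀ {a b c} → Injective _≡_ _≡_ (join₃ {a} {b} {c})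
join₃-injective {x = v} {y = w} e = trans (sym (part∘join₃ v)) (trans (cong part e) (part∘join₃ w))

module Delta (G₁ G₂ G₃ : Graph) (v₁ : Fin (n G₁)) (v₂ : Fin (n G₂)) (v₃ : Fin (n G₃)) where

  Vertex : Set
  Vertex = Fin (n G₁) ⊎ (Fin (n G₂) ⊎ Fin (n G₃))

  onTriangle : Vertex → Bool
  onTriangle (inj₁ a)        = ⌊ a ≟ v₁ ⌋
  onTriangle (inj₂ (inj₁ b)) = ⌊ b ≟ v₂ ⌋
  onTriangle (inj₂ (inj₂ c)) = ⌊ c ≟ v₃ ⌋

  adjΔ : Vertex → Vertex → Bool
  adjΔ (inj₁ a)        (inj₁ b)        = adj G₁ a b
  adjΔ (inj₂ (inj₁ a)) (inj₂ (inj₁ b)) = adj G₂ a b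
  adjΔ (inj₂ (inj₂ a)) (inj₂ (inj₂ b)) = adj G₃ a b
  adjΔ (inj₁ a)        y               = onTriangle (inj₁ a) ∧ onTriangle y
  adjΔ (inj₂ (inj₁ a)) y               = onTriangle (inj₂ (inj₁ a)) ∧ onTriangle y
  adjΔ (inj₂ (inj₂ a)) y               = onTriangle (inj₂ (inj₂ a)) ∧ onTriangle y

  D : Graph
  D = deltaComp G₁ G₂ G₃ v₁ v₂ v₃

  adj-part : ∀ x y → adj D x y ≡ adjΔ (part x) (part y)
  adj-part x y with part {n G₁} {n G₂} {n G₃} x | part {n G₁} {n G₂} {n G₃} y
  ... | inj₁ a        | inj₁ b        = refl
  ... | inj₁ a        | inj₂ (inj₁ b) = refl
  ... | inj₁ a        | inj₂ (inj₂ b) = refl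
  ... | inj₂ (inj₁ a) | inj₁ b        = refl
  ... | inj₂ (inj₁ a) | inj₂ (inj₁ b) = refl
  ... | inj₂ (inj₁ a) | inj₂ (inj₂ b) = refl
  ... | inj₂ (inj₂ a) | inj₁ b        = refl
  ... | inj₂ (inj₂ a) | inj₂ (inj₁ b) = refl
  ... | inj₂ (inj₂ a) | inj₂ (inj₂ b) = refl

  adj-join₃ : ∀ v w → adj D (join₃ v) (join₃ w) ≡ adjΔ v w
  adj-join₃ v w = trans (adj-part (join₃ v) (join₃ w)) (cong₂ adjΔ (part∘join₃ v) (part∘join₃ w))

  adjΔ-sym : ∀ v w → adjΔ v w ≡ adjΔ w v
  adjΔ-sym v w = trans (sym (adj-join₃ v w)) (trans (Graph.sym D (join₃ v) (join₃ w)) (adj-join₃ w v))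

  component : Fin 3 → Graph
  component zero             = G₁
  component (suc zero)       = G₂
  component (suc (suc zero)) = G₃

  root : ∀ p → Fin (n (component p))
  root zero             = v₁
  root (suc zero)       = v₂
  root (suc (suc zero)) = v₃

  inject : ∀ p → Fin (n (component p)) → Vertex
  inject zero             = inj₁
  inject (suc zero)       = inj₂ ∘ inj₁
  inject (suc (suc zero)) = inj₂ ∘ inj₂

  inject-injective : ∀ p → Injective _≡_ _≡_ (inject p)
  inject-injective zero             refl = refl
  inject-injective (suc zero)       refl = refl
  inject-injective (suc (suc zero)) refl = refl

  adjΔ-inside : ∀ p a b → adjΔ (inject p a) (inject p b) ≡ adj (component p) a b
  adjΔ-inside zero             a b = refl
  adjΔ-inside (suc zero)       a b = refl
  adjΔ-inside (suc (suc zero)) a b = refl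

  adjΔ-across : ∀ p q → ¬ p ≡ q → ∀ a b → adjΔ (inject p a) (inject q b) ≡ ⌊ a ≟ root p ⌋ ∧ ⌊ b ≟ root q ⌋
  adjΔ-across zero             zero             p≢q = ⊥-elim (p≢q refl)
  adjΔ-across zero             (suc zero)       _   a b = refl
  adjΔ-across zero             (suc (suc zero)) _   a b = refl
  adjΔ-across (suc zero)       zero             _   a b = refl
  adjΔ-across (suc zero)       (suc zero)       p≢q = ⊥-elim (p≢q refl)
  adjΔ-across (suc zero)       (suc (suc zero)) _   a b = refl
  adjΔ-across (suc (suc zero)) zero             _   a b = refl
  adjΔ-across (suc (suc zero)) (suc zero)       _   a b = refl
  adjΔ-across (suc (suc zero)) (suc (suc zero)) p≢q = ⊥-elim (p≢q refl)

  inject-surjective : ∀ v → Σ (Fin 3) λ p → Σ (Fin (n (component p))) λ a → inject p a ≡ v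
  inject-surjective (inj₁ a)        = zero , a , refl
  inject-surjective (inj₂ (inj₁ a)) = suc zero , a , refl
  inject-surjective (inj₂ (inj₂ a)) = suc (suc zero) , a , refl

⟨$⟩ʳ-injective : ∀ {m k} (π : Permutation m k) → Injective _≡_ _≡_ (π ⟨$⟩ʳ_)
⟨$⟩ʳ-injective π e = trans (sym (inverseˡ π)) (trans (cong (π ⟨$⟩ˡ_) e) (inverseˡ π))

⟨$⟩ˡ-injective : ∀ {m k} (π : Permutation m k) → Injective _≡_ _≡_ (π ⟨$⟩ˡ_)
⟨$⟩ˡ-injective π e = trans (sym (inverseʳ π)) (trans (cong (π ⟨$⟩ʳ_) e) (inverseʳ π))

≅-adj⁻ : ∀ {G H} (φ : G ≅ H) d d′ → adj G (proj₁ φ ⟨$⟩ˡ d) (proj₁ φ ⟨$⟩ˡ d′) ≡ adj H d d′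
≅-adj⁻ {G} {H} (φ , φ-adj) d d′ = trans (sym (φ-adj (φ ⟨$⟩ˡ d) (φ ⟨$⟩ˡ d′))) (cong₂ (adj H) (inverseʳ φ) (inverseʳ φ))

record DeltaDecomposition (G : Graph) : Set where
  field
    H               : Fin 3 → Graph
    root            : ∀ p → Fin (n (H p))
    embed           : ∀ p → Fin (n (H p)) → Fin (n G)
    embed-injective : ∀ p → Injective _≡_ _≡_ (embed p)
    embed-adj       : ∀ p a b → adj G (embed p a) (embed p b) ≡ adj (H p) a b
    across-adj      : ∀ p q → ¬ p ≡ q → ∀ a b → adj G (embed p a) (embed q b) ≡ ⌊ a ≟ root p ⌋ ∧ ⌊ b ≟ root q ⌋
    embed-cover     : ∀ g → Σ (Fin 3) λ p → Σ (Fin (n (H p))) λ a → embed p a ≡ g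

≅delta⇒decomposition : ∀ {G} G₁ G₂ G₃ v₁ v₂ v₃ → G ≅ deltaComp G₁ G₂ G₃ v₁ v₂ v₃ → DeltaDecomposition G
≅delta⇒decomposition {G} G₁ G₂ G₃ v₁ v₂ v₃ φ = record
  { H               = component
  ; root            = root
  ; embed           = embed
  ; embed-injective = λ p → inject-injective p ∘ join₃-injective ∘ ⟨$⟩ˡ-injective (proj₁ φ)
  ; embed-adj       = λ p a b → trans (adj-embed p p a b) (adjΔ-inside p a b)
  ; across-adj      = λ p q p≢q a b → trans (adj-embed p q a b) (adjΔ-across p q p≢q a b)
  ; embed-cover     = cover
  }
  where
  open Delta G₁ G₂ G₃ v₁ v₂ v₃
  embed : ∀ p → Fin (n (component p)) → Fin (n G)
  embed p a = proj₁ φ ⟨$⟩ˡ join₃ (inject p a)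
  adj-embed : ∀ p q a b → adj G (embed p a) (embed q b) ≡ adjΔ (inject p a) (inject q b)
  adj-embed p q a b = trans (≅-adj⁻ {G} {D} φ (join₃ (inject p a)) (join₃ (inject q b))) (adj-join₃ (inject p a) (inject q b))
  cover : ∀ g → Σ (Fin 3) λ p → Σ (Fin (n (component p))) λ a → embed p a ≡ g
  cover g = let (p , a , e) = inject-surjective (part (proj₁ φ ⟨$⟩ʳ g))
            in p , a , trans (cong (λ v → proj₁ φ ⟨$⟩ˡ join₃ v) e)
                             (trans (cong (proj₁ φ ⟨$⟩ˡ_) (join₃∘part {n G₁} {n G₂} {n G₃} _)) (inverseˡ (proj₁ φ)))

-- Lower bound

prefixᵇ : ∀ {m} → Permutation′ m → ℕ → Fin m → Bool
prefixᵇ π i v = ⌊ toℕ (π ⟨$⟩ˡ v) <? i ⌋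

lookup-prefix : ∀ G (π : Layout G) i v → lookup (prefix G π i) v ≡ prefixᵇ π i v
lookup-prefix G π i = lookup∘tabulate _

⌊<?⌋≡true⇒< : ∀ {m t} → ⌊ m <? t ⌋ ≡ true → m < t
⌊<?⌋≡true⇒< {m} {t} e with m <? t
... | yes m<t = m<t

⌊<?⌋≡false⇒≥ : ∀ {m t} → ⌊ m <? t ⌋ ≡ false → t ≤ m
⌊<?⌋≡false⇒≥ {m} {t} e with m <? t
... | no m≮t = ≮⇒≥ m≮t

<⇒⌊<?⌋≡true : ∀ {m t} → m < t → ⌊ m <? t ⌋ ≡ true
<⇒⌊<?⌋≡true {m} {t} m<t = trans (isYes≗does (m <? t)) (dec-true (m <? t) m<t)

≥⇒⌊<?⌋≡false : ∀ {m t} → t ≤ m → ⌊ m <? t ⌋ ≡ false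
≥⇒⌊<?⌋≡false {m} {t} t≤m = trans (isYes≗does (m <? t)) (dec-false (m <? t) (≤⇒≯ t≤m))

Connected : Graph → Set
Connected H = ∀ (P : Fin (n H) → Bool) x y → P x ≡ true → P y ≡ false →
  Σ (Fin (n H)) λ a → Σ (Fin (n H)) λ b → P a ≡ true × P b ≡ false × adj H a b ≡ true

≅K2⇒connected : ∀ {G} → G ≅ K2 → Connected G
≅K2⇒connected {G} (φ , φ-adj) P x y Px Py = x , y , Px , Py , trans (sym (φ-adj x y)) φx≢φy
  where
  φx≢φy : not ⌊ φ ⟨$⟩ʳ x ≟ φ ⟨$⟩ʳ y ⌋ ≡ true
  φx≢φy with φ ⟨$⟩ʳ x ≟ φ ⟨$⟩ʳ y
  ... | no  _ = refl
  ... | yes e = ⊥-elim (true≢false (trans (sym Px) (trans (cong P (⟨$⟩ʳ-injective φ e)) Py)))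

decomposition-connected : ∀ {G} (Δ : DeltaDecomposition G) →
                          (∀ p → Connected (DeltaDecomposition.H Δ p)) → Connected G
decomposition-connected {G} Δ conn P x y Px Py
  with DeltaDecomposition.embed-cover Δ x | DeltaDecomposition.embed-cover Δ y
... | p , a , refl | q , b , refl = go
  where
  open DeltaDecomposition Δ
  within : ∀ r c c′ → P (embed r c) ≡ true → P (embed r c′) ≡ false →
           Σ (Fin (n G)) λ a → Σ (Fin (n G)) λ b → P a ≡ true × P b ≡ false × adj G a b ≡ true
  within r c c′ Pc Pc′ =
    let (d , d′ , Pd , Pd′ , e) = conn r (P ∘ embed r) c c′ Pc Pc′
    in embed r d , embed r d′ , Pd , Pd′ , trans (embed-adj r d d′) e
  go : Σ (Fin (n G)) λ a → Σ (Fin (n G)) λ b → P a ≡ true × P b ≡ false × adj G a b ≡ true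
  go with all? (λ c → P (embed p c) ≟ᵇ true) | all? (λ c → P (embed q c) ≟ᵇ false)
  ... | no  ¬all-p | _ = let (c , Pc≢1) = ¬∀⟶∃¬ _ _ (λ c → P (embed p c) ≟ᵇ true) ¬all-p in within p a c Px (¬-not Pc≢1)
  ... | yes _ | no ¬all-q = let (c , Pc≢0) = ¬∀⟶∃¬ _ _ (λ c → P (embed q c) ≟ᵇ false) ¬all-q in within q c b (¬-not Pc≢0) Py
  ... | yes all-p | yes all-q with p ≟ q
  ...   | yes refl = ⊥-elim (true≢false (trans (sym (all-p b)) (all-q b)))
  ...   | no  p≢q  = embed p (root p) , embed q (root q) , all-p (root p) , all-q (root q) ,
                     trans (across-adj p q p≢q _ _) (cong₂ _∧_ (≟-refl (root p)) (≟-refl (root q)))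

InDelta⇒connected : ∀ {k G} → InDelta k G → Connected G
InDelta⇒connected {G = G} (base φ) = ≅K2⇒connected {G} φ
InDelta⇒connected {G = G} (step G₁ G₂ G₃ v₁ v₂ v₃ d₁ d₂ d₃ φ) =
  decomposition-connected (≅delta⇒decomposition {G} G₁ G₂ G₃ v₁ v₂ v₃ φ) connected
  where
  connected : ∀ p → Connected (Delta.component G₁ G₂ G₃ v₁ v₂ v₃ p)
  connected zero             = InDelta⇒connected d₁
  connected (suc zero)       = InDelta⇒connected d₂
  connected (suc (suc zero)) = InDelta⇒connected d₃

CutWitness : (G : Graph) → (Fin (n G) → ℕ) → ℕ → ∀ {r} → Vec (Fin (n G)) r → Set
CutWitness G pos t xs = (∀ s → pos (lookup xs s) < t) × IndependentRows (adj G) (λ c → t ≤ pos c) xs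

-- Every injective vertex ordering of G has a cut of rank at least r.
ForcesCutRk : Graph → ℕ → Set
ForcesCutRk G r = ∀ (pos : Fin (n G) → ℕ) → Injective _≡_ _≡_ pos →
                  Σ ℕ λ t → Σ (Vec (Fin (n G)) r) (CutWitness G pos t)

edge⇒cutWitness : ∀ G (pos : Fin (n G) → ℕ) x y → adj G x y ≡ true → pos x < pos y →
                  CutWitness G pos (suc (pos x)) (x ∷ [])
edge⇒cutWitness G pos x y xy x<y = (λ { zero → ≤-refl }) , λ { sel (zero , sel-0) →
  y , x<y , trans (cong (λ b → b ∧ adj G x y xor false) sel-0) (cong (_xor false) xy) }

edge⇒forcesCutRk1 : ∀ G x y → adj G x y ≡ true → ForcesCutRk G 1
edge⇒forcesCutRk1 G x y xy pos pos-inj with <-cmp (pos x) (pos y)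
... | tri< x<y _ _ = suc (pos x) , x ∷ [] , edge⇒cutWitness G pos x y xy x<y
... | tri> _ _ y<x = suc (pos y) , y ∷ [] , edge⇒cutWitness G pos y x (trans (Graph.sym G y x) xy) y<x
... | tri≈ _ x≡y _ with pos-inj x≡y
...   | refl = ⊥-elim (true≢false (trans (sym xy) (irrefl G x)))

≅K2⇒forcesCutRk : ∀ {G} → G ≅ K2 → ForcesCutRk G 1
≅K2⇒forcesCutRk {G} φ = edge⇒forcesCutRk1 G _ _ (≅-adj⁻ {G} {K2} φ zero (suc zero))

-- The median cut t of component j carries its k independent rows; component a
-- reaches before t and component c beyond it, and either one of them has an edge
-- crossing t, or the triangle edge between their roots does. Either way that
-- edge supplies one further independent row.
module ExtraRow {G : Graph} (Δ : DeltaDecomposition G) (pos : Fin (n G) → ℕ) (t : ℕ) {k : ℕ}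
  (j a c : Fin 3) (j≢a : ¬ j ≡ a) (j≢c : ¬ j ≡ c) (a≢c : ¬ a ≡ c)
  (conn-a : Connected (DeltaDecomposition.H Δ a)) (conn-c : Connected (DeltaDecomposition.H Δ c))
  (xs : Vec (Fin (n (DeltaDecomposition.H Δ j))) k)
  (xs-witness : CutWitness (DeltaDecomposition.H Δ j) (pos ∘ DeltaDecomposition.embed Δ j) t xs)
  (α : Fin (n (DeltaDecomposition.H Δ a))) (α<t : pos (DeltaDecomposition.embed Δ a α) < t)
  (γ : Fin (n (DeltaDecomposition.H Δ c))) (t≤γ : t ≤ pos (DeltaDecomposition.embed Δ c γ)) where

  open DeltaDecomposition Δ

  After : Fin (n G) → Set
  After z = t ≤ pos z

  AfterInJ : Fin (n G) → Set
  AfterInJ z = After z × ∃ λ z′ → embed j z′ ≡ z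

  ys : Vec (Fin (n G)) k
  ys = map (embed j) xs

  lookup-ys : ∀ s → lookup ys s ≡ embed j (lookup xs s)
  lookup-ys s = lookup-map s (embed j) xs

  ys-independent : IndependentRows (adj G) AfterInJ ys
  ys-independent sel sel≠0 =
    let (z′ , z′-after , h) = proj₂ xs-witness sel sel≠0
    in embed j z′ , (z′-after , z′ , refl) ,
       trans (sum-cong-≗ (λ s → cong (sel s ∧_) (trans (cong (λ v → adj G v (embed j z′)) (lookup-ys s))
                                                        (embed-adj j _ z′)))) h

  Result : Set
  Result = Σ (Vec (Fin (n G)) (suc k)) (CutWitness G pos t)

  with-row : ∀ x → pos x < t → IndependentRows (adj G) After (x ∷ ys) → Result
  with-row x x<t ind = x ∷ ys , before , ind
    where
    before : ∀ s → pos (lookup (x ∷ ys) s) < t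
    before zero    = x<t
    before (suc s) = subst (λ v → pos v < t) (sym (lookup-ys s)) (proj₁ xs-witness s)

  before≢after : ∀ {x y} → pos x < t → t ≤ pos y → ¬ x ≡ y
  before≢after x<t t≤y refl = <-irrefl refl (<-≤-trans x<t t≤y)

  crossing-edge : ∀ b → ¬ j ≡ b → ∀ x y → pos (embed b x) < t → t ≤ pos (embed b y) → adj (H b) x y ≡ true → Result
  crossing-edge b j≢b x y x<t t≤y xy with x ≟ root b
  ... | yes refl = with-row _ x<t
      (∷-independent-freshColumn (adj G) {xs = ys} (embed b y) t≤y (trans (embed-adj b x y) xy) ys-y
        (independentRows-mono (adj G) {xs = ys} proj₁ ys-independent))
    where
    ys-y : ∀ s → adj G (lookup ys s) (embed b y) ≡ false
    ys-y s = trans (cong (λ v → adj G v (embed b y)) (lookup-ys s))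
                   (trans (across-adj j b j≢b _ y)
                          (trans (cong (⌊ lookup xs s ≟ root j ⌋ ∧_)
                                       (≢⇒≟-false (λ y≡x → before≢after x<t t≤y (cong (embed b) (sym y≡x)))))
                                 (∧-zeroʳ _)))
  ... | no x≢root = with-row _ x<t
      (∷-independent-disjointSupport (adj G) {xs = ys} (embed b y) t≤y (trans (embed-adj b x y) xy)
        proj₁ x-on-j ys-independent)
    where
    x-on-j : ∀ z → AfterInJ z → adj G (embed b x) z ≡ false
    x-on-j _ (_ , z′ , refl) = trans (across-adj b j (j≢b ∘ sym) x z′) (cong (_∧ ⌊ z′ ≟ root j ⌋) (≢⇒≟-false x≢root))

  triangle :  adj G (embed a (root a)) (embed c (root c)) ≡ true
  triangle = trans (across-adj a c a≢c _ _) (cong₂ _∧_ (≟-refl (root a)) (≟-refl (root c)))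

  triangle-edge : (∀ y → pos (embed a y) < t) → (∀ z → t ≤ pos (embed c z)) → Result
  triangle-edge a-before c-after with pos (embed j (root j)) <? t
  ... | yes root-j<t = with-row _ (a-before (root a))
      (∷-independent-disjointSupport (adj G) {xs = ys} (embed c (root c)) (c-after (root c)) triangle
        proj₁ root-a-on-j ys-independent)
    where
    root-a-on-j : ∀ z → AfterInJ z → adj G (embed a (root a)) z ≡ false
    root-a-on-j _ (z-after , z′ , refl) =
      trans (across-adj a j (j≢a ∘ sym) (root a) z′)
            (cong₂ _∧_ (≟-refl (root a))
                       (≢⇒≟-false (λ z′≡root → before≢after root-j<t z-after (cong (embed j) (sym z′≡root)))))
  ... | no root-j≮t = with-row _ (a-before (root a))
      (∷-independent-freshColumn (adj G) {xs = ys} (embed c (root c)) (c-after (root c)) triangle ys-root-c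
        (independentRows-mono (adj G) {xs = ys} proj₁ ys-independent))
    where
    ys-root-c : ∀ s → adj G (lookup ys s) (embed c (root c)) ≡ false
    ys-root-c s = trans (cong (λ v → adj G v (embed c (root c))) (lookup-ys s))
                        (trans (across-adj j c j≢c _ _)
                               (trans (cong (_∧ ⌊ root c ≟ root c ⌋)
                                            (≢⇒≟-false (λ e → root-j≮t (subst (λ v → pos (embed j v) < t) e (proj₁ xs-witness s)))))
                                      refl))

  result : Result
  result with all? (λ y → pos (embed a y) <? t)
  ... | no ¬a-before =
    let (y , y≮t) = ¬∀⟶∃¬ _ _ (λ y → pos (embed a y) <? t) ¬a-before
        (x , y′ , x<t , y′≮t , xy) = conn-a (λ z → ⌊ pos (embed a z) <? t ⌋) α y (<⇒⌊<?⌋≡true α<t) (≥⇒⌊<?⌋≡false (≮⇒≥ y≮t))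
    in crossing-edge a j≢a x y′ (⌊<?⌋≡true⇒< x<t) (⌊<?⌋≡false⇒≥ y′≮t) xy
  ... | yes a-before with all? (λ z → t ≤? pos (embed c z))
  ...   | yes c-after = triangle-edge a-before c-after
  ...   | no ¬c-after =
    let (z , z≱t) = ¬∀⟶∃¬ _ _ (λ z → t ≤? pos (embed c z)) ¬c-after
        (x , y′ , x<t , y′≮t , xy) = conn-c (λ w → ⌊ pos (embed c w) <? t ⌋) z γ (<⇒⌊<?⌋≡true (≰⇒> z≱t)) (≥⇒⌊<?⌋≡false t≤γ)
    in crossing-edge c j≢c x y′ (⌊<?⌋≡true⇒< x<t) (⌊<?⌋≡false⇒≥ y′≮t) xy

record MedianOf (t : Fin 3 → ℕ) : Set where
  constructor median-of
  field
    j a c : Fin 3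
    j≢a   : ¬ j ≡ a
    j≢c   : ¬ j ≡ c
    a≢c   : ¬ a ≡ c
    a≤j   : t a ≤ t j
    j≤c   : t j ≤ t c

median : ∀ t → MedianOf t
median t with t zero ≤? t (suc zero) | t (suc zero) ≤? t (suc (suc zero)) | t zero ≤? t (suc (suc zero))
... | yes 0≤1 | yes 1≤2 | _       = median-of (suc zero) zero (suc (suc zero)) (λ ()) (λ ()) (λ ()) 0≤1 1≤2
... | yes 0≤1 | no  1≰2 | yes 0≤2 = median-of (suc (suc zero)) zero (suc zero) (λ ()) (λ ()) (λ ()) 0≤2 (<⇒≤ (≰⇒> 1≰2))
... | yes 0≤1 | no  _   | no  0≰2 = median-of zero (suc (suc zero)) (suc zero) (λ ()) (λ ()) (λ ()) (<⇒≤ (≰⇒> 0≰2)) 0≤1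
... | no  0≰1 | _       | yes 0≤2 = median-of zero (suc zero) (suc (suc zero)) (λ ()) (λ ()) (λ ()) (<⇒≤ (≰⇒> 0≰1)) 0≤2
... | no  _   | yes 1≤2 | no  0≰2 = median-of (suc (suc zero)) (suc zero) zero (λ ()) (λ ()) (λ ()) 1≤2 (<⇒≤ (≰⇒> 0≰2))
... | no  0≰1 | no  1≰2 | no  _   = median-of (suc zero) (suc (suc zero)) zero (λ ()) (λ ()) (λ ()) (<⇒≤ (≰⇒> 1≰2)) (<⇒≤ (≰⇒> 0≰1))

InDelta⇒forcesCutRk : ∀ {k G} → InDelta k G → ForcesCutRk G (suc k)
InDelta⇒forcesCutRk {G = G} (base φ) = ≅K2⇒forcesCutRk {G} φ
InDelta⇒forcesCutRk {suc k} {G} (step G₁ G₂ G₃ v₁ v₂ v₃ d₁ d₂ d₃ φ) pos pos-inj =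
  cut j , ExtraRow.result Δ pos (cut j) j a c j≢a j≢c a≢c (connected a) (connected c) (rows j) (witness j)
            (lookup (rows a) zero) (<-≤-trans (proj₁ (witness a) zero) a≤j)
            (proj₁ (beyond c)) (≤-trans j≤c (proj₂ (beyond c)))
  where
  Δ = ≅delta⇒decomposition {G} G₁ G₂ G₃ v₁ v₂ v₃ φ
  open DeltaDecomposition Δ
  connected : ∀ p → Connected (H p)
  connected zero             = InDelta⇒connected d₁
  connected (suc zero)       = InDelta⇒connected d₂
  connected (suc (suc zero)) = InDelta⇒connected d₃
  pos-inj′ : ∀ p → Injective _≡_ _≡_ (pos ∘ embed p)
  pos-inj′ p e = embed-injective p (pos-inj e)
  cut-of : ∀ p → Σ ℕ λ t → Σ (Vec (Fin (n (H p))) (suc k)) (CutWitness (H p) (pos ∘ embed p) t)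
  cut-of zero             = InDelta⇒forcesCutRk d₁ (pos ∘ embed zero) (pos-inj′ zero)
  cut-of (suc zero)       = InDelta⇒forcesCutRk d₂ (pos ∘ embed (suc zero)) (pos-inj′ (suc zero))
  cut-of (suc (suc zero)) = InDelta⇒forcesCutRk d₃ (pos ∘ embed (suc (suc zero))) (pos-inj′ (suc (suc zero)))
  cut : Fin 3 → ℕ
  cut p = proj₁ (cut-of p)
  rows : ∀ p → Vec (Fin (n (H p))) (suc k)
  rows p = proj₁ (proj₂ (cut-of p))
  witness : ∀ p → CutWitness (H p) (pos ∘ embed p) (cut p) (rows p)
  witness p = proj₂ (proj₂ (cut-of p))
  beyond : ∀ p → Σ (Fin (n (H p))) λ z → cut p ≤ pos (embed p z)
  beyond p = let (z , z-after , _) = proj₂ (witness p) (λ s → ⌊ s ≟ zero ⌋) (zero , ≟-refl {suc k} zero) in z , z-after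
  open MedianOf (median cut)

forcesCutRk⇒lrw≥ : ∀ {H G r s} (e : Fin (n H) → Fin (n G)) → Injective _≡_ _≡_ e →
                   (∀ a b → adj G (e a) (e b) ≡ adj H a b) → ForcesCutRk H r → LrwLe G s → r ≤ s
forcesCutRk⇒lrw≥ {H} {G} {r} {s} e e-inj e-adj forces (π , width) =
  cutRkLe⇒independentRows≤ G X s (width t) ys ys⊆X ys-independent
  where
  pos : Fin (n H) → ℕ
  pos a = toℕ (π ⟨$⟩ˡ e a)
  pos-inj : Injective _≡_ _≡_ pos
  pos-inj = e-inj ∘ ⟨$⟩ˡ-injective π ∘ toℕ-injective
  t  = proj₁ (forces pos pos-inj)
  xs = proj₁ (proj₂ (forces pos pos-inj))
  xs-before = proj₁ (proj₂ (proj₂ (forces pos pos-inj)))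
  xs-independent = proj₂ (proj₂ (proj₂ (forces pos pos-inj)))
  X : Subset (n G)
  X = prefix G π t
  ys : Vec (Fin (n G)) r
  ys = map e xs
  ys⊆X : ∀ u → lookup ys u ∈ X
  ys⊆X u = true⇒∈ (trans (lookup-prefix G π t _)
                          (<⇒⌊<?⌋≡true (subst (λ v → toℕ (π ⟨$⟩ˡ v) < t) (sym (lookup-map u e xs)) (xs-before u))))
  ys-independent : IndependentRows (adj G) (_∈ ∁ X) ys
  ys-independent sel sel≠0 =
    let (c , c-after , h) = xs-independent sel sel≠0
    in e c , false⇒∈∁ X (trans (lookup-prefix G π t (e c)) (≥⇒⌊<?⌋≡false c-after)) ,
       trans (sum-cong-≗ (λ u → cong (sel u ∧_) (trans (cong (λ v → adj G v (e c)) (lookup-map u e xs)) (e-adj _ c)))) h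

deltaComp-lrw≥ : ∀ {k} G₁ G₂ G₃ v₁ v₂ v₃ → InDelta k G₁ → ∀ s → LrwLe (deltaComp G₁ G₂ G₃ v₁ v₂ v₃) s → suc k ≤ s
deltaComp-lrw≥ {k} G₁ G₂ G₃ v₁ v₂ v₃ d₁ s =
  forcesCutRk⇒lrw≥ {G₁} {D} {suc k} {s}
    (join₃ {n G₁} {n G₂} {n G₃} ∘ inj₁) (inj₁-injective ∘ join₃-injective {n G₁} {n G₂} {n G₃})
    (λ a b → adj-join₃ (inj₁ a) (inj₁ b)) (InDelta⇒forcesCutRk d₁)
  where open Delta G₁ G₂ G₃ v₁ v₂ v₃

-- Upper bound

module _ {V : Set} {M : V → V → Bool} where

  FactorsThrough-mono : ∀ {X r r′} → r ≤ r′ → FactorsThrough M X r → FactorsThrough M X r′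
  FactorsThrough-mono r≤r′ (factorization m m≤r C B fac) = factorization m (≤-trans m≤r r≤r′) C B fac

  FactorsThrough-cong : ∀ {X X′ r} → (∀ v → X v ≡ X′ v) → FactorsThrough M X r → FactorsThrough M X′ r
  FactorsThrough-cong X≗X′ (factorization m m≤r C B fac) =
    factorization m m≤r C B λ x y Xx Xy → fac x y (trans (X≗X′ x) Xx) (trans (X≗X′ y) Xy)

  -- For a symmetric matrix the cut matrix at ∁X is the transpose of the one at X.
  FactorsThrough-∁ : ∀ {X r} → (∀ x y → M x y ≡ M y x) → FactorsThrough M X r → FactorsThrough M (not ∘ X) r
  FactorsThrough-∁ {X} M-sym (factorization m m≤r C B fac) =
    factorization m m≤r (λ y t → B t y) (λ t x → C x t) λ x y ¬Xx ¬Xy →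
      trans (M-sym x y) (trans (fac y x (not-injective ¬Xy) (not-injective ¬Xx)) (sum-cong-≗ (λ t → ∧-comm (C y t) (B t x))))

FactorsThrough-pullback : ∀ {V W : Set} {M : V → V → Bool} {N : W → W → Bool} {X r} (f : V → W) →
                          (∀ x y → N (f x) (f y) ≡ M x y) → FactorsThrough N X r → FactorsThrough M (X ∘ f) r
FactorsThrough-pullback f N∘f≡M (factorization m m≤r C B fac) =
  factorization m m≤r (C ∘ f) (λ t y → B t (f y)) λ x y Xx Xy → trans (sym (N∘f≡M x y)) (fac (f x) (f y) Xx Xy)

factorsThrough-singleRow : ∀ {V : Set} (M : V → V → Bool) (X : V → Bool) x₀ →
                           (∀ x → X x ≡ true → x ≡ x₀) → FactorsThrough M X 1
factorsThrough-singleRow M X x₀ X⊆x₀ =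
  factorization 1 ≤-refl (λ _ _ → true) (λ _ → M x₀) λ x y Xx _ →
    trans (cong (λ z → M z y) (X⊆x₀ x Xx)) (sym (xor-identityʳ (M x₀ y)))

factorsThrough-singleColumn : ∀ {V : Set} (M : V → V → Bool) (X : V → Bool) y₀ →
                              (∀ y → X y ≡ false → y ≡ y₀) → FactorsThrough M X 1
factorsThrough-singleColumn M X y₀ ∁X⊆y₀ =
  factorization 1 ≤-refl (λ x _ → M x y₀) (λ _ _ → true) λ x y _ Xy →
    trans (cong (M x) (∁X⊆y₀ y Xy)) (sym (trans (xor-identityʳ _) (∧-identityʳ (M x y₀))))

transportLayout : ∀ {m k} → Permutation m k → Permutation′ k → Permutation′ m
transportLayout φ π = cast-id (↔⇒≡ φ) ∘ₚ π ∘ₚ flip φ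

prefix-transport : ∀ {m k} (φ : Permutation m k) (π : Permutation′ k) i g →
                   prefixᵇ (transportLayout φ π) i g ≡ prefixᵇ π i (φ ⟨$⟩ʳ g)
prefix-transport φ π i g = cong (λ p → ⌊ p <? i ⌋) (toℕ-cast _ _)

reverseLayout : ∀ {m} → Permutation′ m → Permutation′ m
reverseLayout π = reverse ∘ₚ π

∸-suc-<?-flip : ∀ m p j → p < m → ⌊ m ∸ suc p <? j ⌋ ≡ not ⌊ p <? m ∸ j ⌋
∸-suc-<?-flip m p j p<m with p <? m ∸ j
... | yes p<m∸j with j ≤? m
...   | yes j≤m = ≥⇒⌊<?⌋≡false (m+n≤o⇒m≤o∸n j (subst (_≤ m) (+-comm (suc p) j) (m≤o∸n⇒m+n≤o (suc p) j≤m p<m∸j)))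
...   | no  j≰m with subst (suc p ≤_) (m≤n⇒m∸n≡0 (<⇒≤ (≰⇒> j≰m))) p<m∸j
...     | ()
∸-suc-<?-flip m p j p<m | no p≮m∸j = <⇒⌊<?⌋≡true (≰⇒> λ j≤q → p≮m∸j (p<m∸j j≤q))
  where
  q = m ∸ suc p
  p<m∸j : j ≤ q → p < m ∸ j
  p<m∸j j≤q = subst (_≤ m ∸ j) (trans (cong (_∸ q) (sym (m∸n+n≡m p<m))) (m+n∸m≡n q (suc p))) (∸-monoʳ-≤ m j≤q)

prefix-reverse : ∀ {m} (π : Permutation′ m) j v → prefixᵇ (reverseLayout π) j v ≡ not (prefixᵇ π (m ∸ j) v)
prefix-reverse {m} π j v =
  trans (cong (λ p → ⌊ p <? j ⌋) (opposite-prop (π ⟨$⟩ˡ v))) (∸-suc-<?-flip m _ j (toℕ<n (π ⟨$⟩ˡ v)))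

+-<?-shift : ∀ a p i → a ≤ i → ⌊ a + p <? i ⌋ ≡ ⌊ p <? i ∸ a ⌋
+-<?-shift a p i a≤i with p <? i ∸ a
... | yes p<i∸a = <⇒⌊<?⌋≡true (subst (_≤ i) (trans (+-comm (suc p) a) (+-suc a p)) (m≤o∸n⇒m+n≤o (suc p) a≤i p<i∸a))
... | no  p≮i∸a = ≥⇒⌊<?⌋≡false (≤-trans (m≤n+m∸n i a) (+-monoʳ-≤ a (≤-pred (≰⇒> p≮i∸a))))

Blocks : ℕ → ℕ → ℕ → Set
Blocks a b c = Fin a ⊎ (Fin b ⊎ Fin c)

blockPermutation : ∀ {a b c a′ b′ c′} (σ : Blocks a b c → Blocks a′ b′ c′) (σ⁻ : Blocks a′ b′ c′ → Blocks a b c) →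
                   (∀ w → σ (σ⁻ w) ≡ w) → (∀ v → σ⁻ (σ v) ≡ v) → Permutation (a + (b + c)) (a′ + (b′ + c′))
blockPermutation {a} {b} {c} {a′} {b′} {c′} σ σ⁻ σσ⁻ σ⁻σ =
  permutation (join₃ ∘ σ ∘ part {a} {b} {c}) (join₃ ∘ σ⁻ ∘ part {a′} {b′} {c′})
    (λ y → trans (cong (join₃ ∘ σ) (part∘join₃ (σ⁻ (part y))))
                 (trans (cong join₃ (σσ⁻ (part y))) (join₃∘part {a′} {b′} {c′} y)))
    (λ x → trans (cong (join₃ ∘ σ⁻) (part∘join₃ (σ (part x))))
                 (trans (cong join₃ (σ⁻σ (part x))) (join₃∘part {a} {b} {c} x)))

module Concat {a b c} (π₁ : Permutation′ a) (π₂ : Permutation′ b) (π₃ : Permutation′ c) where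

  private
    to from : Blocks a b c → Blocks a b c
    to (inj₁ x)        = inj₁ (π₁ ⟨$⟩ʳ x)
    to (inj₂ (inj₁ y)) = inj₂ (inj₁ (π₂ ⟨$⟩ʳ y))
    to (inj₂ (inj₂ z)) = inj₂ (inj₂ (π₃ ⟨$⟩ʳ z))
    from (inj₁ x)        = inj₁ (π₁ ⟨$⟩ˡ x)
    from (inj₂ (inj₁ y)) = inj₂ (inj₁ (π₂ ⟨$⟩ˡ y))
    from (inj₂ (inj₂ z)) = inj₂ (inj₂ (π₃ ⟨$⟩ˡ z))
    to∘from : ∀ w → to (from w) ≡ w
    to∘from (inj₁ x)        = cong inj₁ (inverseʳ π₁)
    to∘from (inj₂ (inj₁ y)) = cong (inj₂ ∘ inj₁) (inverseʳ π₂)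
    to∘from (inj₂ (inj₂ z)) = cong (inj₂ ∘ inj₂) (inverseʳ π₃)
    from∘to : ∀ w → from (to w) ≡ w
    from∘to (inj₁ x)        = cong inj₁ (inverseˡ π₁)
    from∘to (inj₂ (inj₁ y)) = cong (inj₂ ∘ inj₁) (inverseˡ π₂)
    from∘to (inj₂ (inj₂ z)) = cong (inj₂ ∘ inj₂) (inverseˡ π₃)

  layout : Permutation′ (a + (b + c))
  layout = blockPermutation to from to∘from from∘to

  position : Blocks a b c → ℕ
  position (inj₁ x)        = toℕ (π₁ ⟨$⟩ˡ x)
  position (inj₂ (inj₁ y)) = a + toℕ (π₂ ⟨$⟩ˡ y)
  position (inj₂ (inj₂ z)) = a + (b + toℕ (π₃ ⟨$⟩ˡ z))

  position-layout : ∀ w → toℕ (layout ⟨$⟩ˡ join₃ w) ≡ position w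
  position-layout w = trans (cong (toℕ ∘ join₃ ∘ from) (part∘join₃ w)) (toℕ-join₃-from w)
    where
    toℕ-join₃-from : ∀ w → toℕ (join₃ {a} {b} {c} (from w)) ≡ position w
    toℕ-join₃-from (inj₁ x)        = toℕ-↑ˡ _ (b + c)
    toℕ-join₃-from (inj₂ (inj₁ y)) = trans (toℕ-↑ʳ a _) (cong (a +_) (toℕ-↑ˡ _ c))
    toℕ-join₃-from (inj₂ (inj₂ z)) = trans (toℕ-↑ʳ a _) (cong (a +_) (toℕ-↑ʳ b _))

  cut : ℕ → Blocks a b c → Bool
  cut i w = ⌊ position w <? i ⌋

  prefix-layout : ∀ i w → prefixᵇ layout i (join₃ w) ≡ cut i w
  prefix-layout i w = cong (λ p → ⌊ p <? i ⌋) (position-layout w)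

  data Regime (i : ℕ) : Set where
    first  : (∀ y → cut i (inj₂ (inj₁ y)) ≡ false) → (∀ z → cut i (inj₂ (inj₂ z)) ≡ false) → Regime i
    second : (∀ x → cut i (inj₁ x) ≡ true) → (∀ y → cut i (inj₂ (inj₁ y)) ≡ prefixᵇ π₂ (i ∸ a) y) →
             (∀ z → cut i (inj₂ (inj₂ z)) ≡ false) → Regime i
    third  : (∀ x → cut i (inj₁ x) ≡ true) → (∀ y → cut i (inj₂ (inj₁ y)) ≡ true) →
             (∀ z → cut i (inj₂ (inj₂ z)) ≡ prefixᵇ π₃ (i ∸ (a + b)) z) → Regime i

  regime : ∀ i → Regime i
  regime i with i ≤? a
  ... | yes i≤a = first (λ _ → ≥⇒⌊<?⌋≡false (≤-trans i≤a (m≤m+n a _))) (λ _ → ≥⇒⌊<?⌋≡false (≤-trans i≤a (m≤m+n a _)))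
  ... | no  i≰a with i ≤? a + b
  ...   | yes i≤a+b = second (λ x → <⇒⌊<?⌋≡true (<-≤-trans (toℕ<n (π₁ ⟨$⟩ˡ x)) a≤i))
                             (λ y → +-<?-shift a _ i a≤i)
                             (λ _ → ≥⇒⌊<?⌋≡false (≤-trans i≤a+b (+-monoʳ-≤ a (m≤m+n b _))))
    where
    a≤i = <⇒≤ (≰⇒> i≰a)
  ...   | no  i≰a+b = third (λ x → <⇒⌊<?⌋≡true (<-≤-trans (toℕ<n (π₁ ⟨$⟩ˡ x)) (<⇒≤ (≰⇒> i≰a))))
                            (λ y → <⇒⌊<?⌋≡true (<-≤-trans (+-monoʳ-< a (toℕ<n (π₂ ⟨$⟩ˡ y))) (<⇒≤ (≰⇒> i≰a+b))))
                            (λ z → trans (cong (λ p → ⌊ p <? i ⌋) (sym (+-assoc a b _)))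
                                         (+-<?-shift (a + b) _ i (<⇒≤ (≰⇒> i≰a+b))))

withPendant : ∀ {V : Set} → (V → V → Bool) → (V → Bool) → V ⊎ ⊤ → V ⊎ ⊤ → Bool
withPendant M N (inj₁ x) (inj₁ y) = M x y
withPendant M N (inj₁ x) (inj₂ _) = N x
withPendant M N (inj₂ _) (inj₁ y) = N y
withPendant M N (inj₂ _) (inj₂ _) = false

pendantCut : ∀ {V : Set} → (V → Bool) → V ⊎ ⊤ → Bool
pendantCut X (inj₁ x) = X x
pendantCut X (inj₂ _) = false

addPendant : ∀ {V : Set} {M : V → V → Bool} {N X : V → Bool} {r} → (∀ x → X x ≡ true → N x ≡ false) →
             FactorsThrough M X r → FactorsThrough (withPendant M N) (pendantCut X) r
addPendant {V} {M} {N} {X} X∩N≡∅ (factorization m m≤r C B fac) = factorization m m≤r C′ B′ fac′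
  where
  C′ : V ⊎ ⊤ → Fin m → Bool
  C′ (inj₁ x) = C x
  C′ (inj₂ _) = λ _ → false
  B′ : Fin m → V ⊎ ⊤ → Bool
  B′ t (inj₁ y) = B t y
  B′ t (inj₂ _) = false
  fac′ : ∀ x y → pendantCut X x ≡ true → pendantCut X y ≡ false → withPendant M N x y ≡ sum (λ t → C′ x t ∧ B′ t y)
  fac′ (inj₁ x) (inj₁ y) Xx Xy = fac x y Xx Xy
  fac′ (inj₁ x) (inj₂ _) Xx _  = trans (X∩N≡∅ x Xx) (sym (∑-zero _ (λ t → ∧-zeroʳ (C x t))))

pendantAt : (G : Graph) → Fin (n G) → Fin (n G) ⊎ ⊤ → Fin (n G) ⊎ ⊤ → Bool
pendantAt G v = withPendant (adj G) (λ a → ⌊ a ≟ v ⌋)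

-- G has a layout all of whose cuts have rank at most r, even with a pendant
-- vertex attached to v and placed after all vertices of G.
PendantWidthLe : (G : Graph) → Fin (n G) → ℕ → Set
PendantWidthLe G v r = Σ (Layout G) λ π → ∀ i → FactorsThrough (pendantAt G v) (pendantCut (prefixᵇ π i)) r

⌊≟⌋-injective : ∀ {k k′} (f : Fin k → Fin k′) → Injective _≡_ _≡_ f → ∀ a b → ⌊ f a ≟ f b ⌋ ≡ ⌊ a ≟ b ⌋
⌊≟⌋-injective f f-inj a b with a ≟ b | f a ≟ f b
... | yes refl | yes _   = refl
... | yes refl | no  ≢   = ⊥-elim (≢ refl)
... | no  a≢b  | yes fab = ⊥-elim (a≢b (f-inj fab))
... | no  _    | no  _   = refl

pendantWidth-≅ : ∀ {G H : Graph} (φ : G ≅ H) v r → PendantWidthLe H (proj₁ φ ⟨$⟩ʳ v) r → PendantWidthLe G v r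
pendantWidth-≅ {G} {H} (φ , φ-adj) v r (π , fac) =
  transportLayout φ π , λ i → FactorsThrough-cong (cut-pullback i) (FactorsThrough-pullback f adj-pullback (fac i))
  where
  f : Fin (n G) ⊎ ⊤ → Fin (n H) ⊎ ⊤
  f (inj₁ a) = inj₁ (φ ⟨$⟩ʳ a)
  f (inj₂ t) = inj₂ t
  adj-pullback : ∀ x y → pendantAt H (φ ⟨$⟩ʳ v) (f x) (f y) ≡ pendantAt G v x y
  adj-pullback (inj₁ a) (inj₁ b) = φ-adj a b
  adj-pullback (inj₁ a) (inj₂ _) = ⌊≟⌋-injective _ (⟨$⟩ʳ-injective φ) a v
  adj-pullback (inj₂ _) (inj₁ b) = ⌊≟⌋-injective _ (⟨$⟩ʳ-injective φ) b v
  adj-pullback (inj₂ _) (inj₂ _) = refl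
  cut-pullback : ∀ i x → pendantCut (prefixᵇ π i) (f x) ≡ pendantCut (prefixᵇ (transportLayout φ π) i) x
  cut-pullback i (inj₁ a) = sym (prefix-transport φ π i a)
  cut-pullback i (inj₂ _) = refl

pendantWidth-K2 : ∀ v → PendantWidthLe K2 v 1
pendantWidth-K2 v = Perm.id , cuts
  where
  cuts : ∀ i → FactorsThrough (pendantAt K2 v) (pendantCut (prefixᵇ Perm.id i)) 1
  cuts zero          = factorsThrough-singleRow _ _ (inj₂ tt) λ { (inj₁ zero) () ; (inj₁ (suc zero)) () ; (inj₂ _) () }
  cuts (suc zero)    = factorsThrough-singleRow _ _ (inj₁ zero) λ { (inj₁ zero) _ → refl ; (inj₁ (suc zero)) () ; (inj₂ _) () }
  cuts (suc (suc i)) = factorsThrough-singleColumn _ _ (inj₂ tt) λ { (inj₁ zero) () ; (inj₁ (suc zero)) () ; (inj₂ _) _ → refl }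

module _ {A B C A′ B′ C′ : Graph} {u v w u′ v′ w′}
         (σ : Delta.Vertex A B C u v w → Delta.Vertex A′ B′ C′ u′ v′ w′)
         (σ⁻ : Delta.Vertex A′ B′ C′ u′ v′ w′ → Delta.Vertex A B C u v w)
         (σσ⁻ : ∀ x → σ (σ⁻ x) ≡ x) (σ⁻σ : ∀ x → σ⁻ (σ x) ≡ x)
         (σ-adj : ∀ x y → Delta.adjΔ A′ B′ C′ u′ v′ w′ (σ x) (σ y) ≡ Delta.adjΔ A B C u v w x y) where

  reorder-≅ : deltaComp A B C u v w ≅ deltaComp A′ B′ C′ u′ v′ w′
  reorder-≅ = blockPermutation σ σ⁻ σσ⁻ σ⁻σ , λ i j →
    trans (Delta.adj-join₃ A′ B′ C′ u′ v′ w′ (σ (part i)) (σ (part j)))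
          (trans (σ-adj _ _) (sym (Delta.adj-part A B C u v w i j)))

swap-≅ : ∀ A B C u v w → deltaComp A B C u v w ≅ deltaComp A C B u w v
swap-≅ A B C u v w = reorder-≅ {A} {B} {C} {A} {C} {B} {u} {v} {w} {u} {w} {v} σ σ σ² σ² σ-adj
  where
  σ : ∀ {X Y Z : Set} → X ⊎ (Y ⊎ Z) → X ⊎ (Z ⊎ Y)
  σ (inj₁ a)        = inj₁ a
  σ (inj₂ (inj₁ b)) = inj₂ (inj₂ b)
  σ (inj₂ (inj₂ c)) = inj₂ (inj₁ c)
  σ² : ∀ {X Y Z : Set} (x : X ⊎ (Y ⊎ Z)) → σ (σ x) ≡ x
  σ² (inj₁ a)        = refl
  σ² (inj₂ (inj₁ b)) = refl
  σ² (inj₂ (inj₂ c)) = refl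
  σ-adj : ∀ x y → Delta.adjΔ A C B u w v (σ x) (σ y) ≡ Delta.adjΔ A B C u v w x y
  σ-adj (inj₁ a)        (inj₁ b)        = refl
  σ-adj (inj₁ a)        (inj₂ (inj₁ b)) = refl
  σ-adj (inj₁ a)        (inj₂ (inj₂ b)) = refl
  σ-adj (inj₂ (inj₁ a)) (inj₁ b)        = refl
  σ-adj (inj₂ (inj₁ a)) (inj₂ (inj₁ b)) = refl
  σ-adj (inj₂ (inj₁ a)) (inj₂ (inj₂ b)) = refl
  σ-adj (inj₂ (inj₂ a)) (inj₁ b)        = refl
  σ-adj (inj₂ (inj₂ a)) (inj₂ (inj₁ b)) = refl
  σ-adj (inj₂ (inj₂ a)) (inj₂ (inj₂ b)) = refl

rotate-≅ : ∀ A B C u v w → deltaComp A B C u v w ≅ deltaComp B C A v w u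
rotate-≅ A B C u v w = reorder-≅ {A} {B} {C} {B} {C} {A} {u} {v} {w} {v} {w} {u} σ σ⁻ σσ⁻ σ⁻σ σ-adj
  where
  σ : Delta.Vertex A B C u v w → Delta.Vertex B C A v w u
  σ (inj₁ a)        = inj₂ (inj₂ a)
  σ (inj₂ (inj₁ b)) = inj₁ b
  σ (inj₂ (inj₂ c)) = inj₂ (inj₁ c)
  σ⁻ : Delta.Vertex B C A v w u → Delta.Vertex A B C u v w
  σ⁻ (inj₁ b)        = inj₂ (inj₁ b)
  σ⁻ (inj₂ (inj₁ c)) = inj₂ (inj₂ c)
  σ⁻ (inj₂ (inj₂ a)) = inj₁ a
  σσ⁻ : ∀ x → σ (σ⁻ x) ≡ x
  σσ⁻ (inj₁ b)        = refl
  σσ⁻ (inj₂ (inj₁ c)) = refl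
  σσ⁻ (inj₂ (inj₂ a)) = refl
  σ⁻σ : ∀ x → σ⁻ (σ x) ≡ x
  σ⁻σ (inj₁ a)        = refl
  σ⁻σ (inj₂ (inj₁ b)) = refl
  σ⁻σ (inj₂ (inj₂ c)) = refl
  σ-adj : ∀ x y → Delta.adjΔ B C A v w u (σ x) (σ y) ≡ Delta.adjΔ A B C u v w x y
  σ-adj (inj₁ a)        (inj₁ b)        = refl
  σ-adj (inj₁ a)        (inj₂ (inj₁ b)) = refl
  σ-adj (inj₁ a)        (inj₂ (inj₂ b)) = refl
  σ-adj (inj₂ (inj₁ a)) (inj₁ b)        = refl
  σ-adj (inj₂ (inj₁ a)) (inj₂ (inj₁ b)) = refl
  σ-adj (inj₂ (inj₁ a)) (inj₂ (inj₂ b)) = refl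
  σ-adj (inj₂ (inj₂ a)) (inj₁ b)        = refl
  σ-adj (inj₂ (inj₂ a)) (inj₂ (inj₁ b)) = refl
  σ-adj (inj₂ (inj₂ a)) (inj₂ (inj₂ b)) = refl

∑-∧-pull : ∀ {m} (C B : Fin m → Bool) z → sum (λ t → C t ∧ (z ∧ B t)) ≡ sum (λ t → C t ∧ B t) ∧ z
∑-∧-pull C B z =
  trans (sum-cong-≗ (λ t → trans (cong (C t ∧_) (∧-comm z (B t))) (sym (∧-assoc (C t) (B t) z))))
        (sym (*-distribʳ-sum z (λ t → C t ∧ B t)))

-- The vertices of a block reach the other blocks only through its root, exactly
-- as they would reach a pendant vertex attached there.
module DeltaCuts (G₁ G₂ G₃ : Graph) (v₁ : Fin (n G₁)) (v₂ : Fin (n G₂)) (v₃ : Fin (n G₃)) where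

  open Delta G₁ G₂ G₃ v₁ v₂ v₃

  private
    impossible : ∀ {A : Set} {b} → b ≡ true → b ≡ false → A
    impossible b≡1 b≡0 = ⊥-elim (true≢false (trans (sym b≡1) b≡0))

    row₁ : Vertex → Bool
    row₁ y = adjΔ (inj₁ v₁) y

    row₁-outside : ∀ z → row₁ (inj₂ z) ≡ onTriangle (inj₂ z)
    row₁-outside z = cong (_∧ onTriangle (inj₂ z)) (≟-refl v₁)

  firstBlockCut : ∀ r (X : Vertex → Bool) (X₁ : Fin (n G₁) → Bool) → (∀ a → X (inj₁ a) ≡ X₁ a) →
    (∀ b → X (inj₂ (inj₁ b)) ≡ false) → (∀ c → X (inj₂ (inj₂ c)) ≡ false) →
    FactorsThrough (pendantAt G₁ v₁) (pendantCut X₁) r → FactorsThrough adjΔ X r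
  firstBlockCut r X X₁ X≡X₁ X₂≡0 X₃≡0 (factorization m m≤r C₁ B₁ fac₁) = factorization m m≤r C B fac
    where
    C : Vertex → Fin m → Bool
    C (inj₁ a) = C₁ (inj₁ a)
    C (inj₂ _) = λ _ → false
    B : Fin m → Vertex → Bool
    B t (inj₁ a) = B₁ t (inj₁ a)
    B t (inj₂ z) = onTriangle (inj₂ z) ∧ B₁ t (inj₂ tt)
    fac : ∀ x y → X x ≡ true → X y ≡ false → adjΔ x y ≡ sum (λ t → C x t ∧ B t y)
    fac (inj₁ a) (inj₁ b) Xx Xy = fac₁ (inj₁ a) (inj₁ b) (trans (sym (X≡X₁ a)) Xx) (trans (sym (X≡X₁ b)) Xy)
    fac (inj₁ a) (inj₂ z) Xx _  =
      trans (cong (_∧ onTriangle (inj₂ z)) (fac₁ (inj₁ a) (inj₂ tt) (trans (sym (X≡X₁ a)) Xx) refl))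
            (sym (∑-∧-pull (C₁ (inj₁ a)) (λ t → B₁ t (inj₂ tt)) (onTriangle (inj₂ z))))
    fac (inj₂ (inj₁ b)) _ Xx _ = impossible Xx (X₂≡0 b)
    fac (inj₂ (inj₂ c)) _ Xx _ = impossible Xx (X₃≡0 c)

  lastBlockCut : ∀ r (X : Vertex → Bool) (X₃ : Fin (n G₃) → Bool) → (∀ a → X (inj₁ a) ≡ false) →
    (∀ b → X (inj₂ (inj₁ b)) ≡ false) → (∀ c → X (inj₂ (inj₂ c)) ≡ X₃ c) →
    FactorsThrough (pendantAt G₃ v₃) (pendantCut X₃) r → FactorsThrough adjΔ X r
  lastBlockCut r X X₃ X₁≡0 X₂≡0 X≡X₃ (factorization m m≤r C₃ B₃ fac₃) = factorization m m≤r C B fac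
    where
    C : Vertex → Fin m → Bool
    C (inj₂ (inj₂ c)) = C₃ (inj₁ c)
    C _               = λ _ → false
    B : Fin m → Vertex → Bool
    B t (inj₂ (inj₂ c)) = B₃ t (inj₁ c)
    B t y               = onTriangle y ∧ B₃ t (inj₂ tt)
    toRoot : ∀ c y → X (inj₂ (inj₂ c)) ≡ true →
             onTriangle (inj₂ (inj₂ c)) ∧ onTriangle y ≡ sum (λ t → C₃ (inj₁ c) t ∧ (onTriangle y ∧ B₃ t (inj₂ tt)))
    toRoot c y Xx = trans (cong (_∧ onTriangle y) (fac₃ (inj₁ c) (inj₂ tt) (trans (sym (X≡X₃ c)) Xx) refl))
                          (sym (∑-∧-pull (C₃ (inj₁ c)) (λ t → B₃ t (inj₂ tt)) (onTriangle y)))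
    fac : ∀ x y → X x ≡ true → X y ≡ false → adjΔ x y ≡ sum (λ t → C x t ∧ B t y)
    fac (inj₂ (inj₂ c)) (inj₂ (inj₂ c′)) Xx Xy = fac₃ (inj₁ c) (inj₁ c′) (trans (sym (X≡X₃ c)) Xx) (trans (sym (X≡X₃ c′)) Xy)
    fac (inj₂ (inj₂ c)) (inj₁ a)         Xx _  = toRoot c (inj₁ a) Xx
    fac (inj₂ (inj₂ c)) (inj₂ (inj₁ b))  Xx _  = toRoot c (inj₂ (inj₁ b)) Xx
    fac (inj₁ a)        _                Xx _  = impossible Xx (X₁≡0 a)
    fac (inj₂ (inj₁ b)) _                Xx _  = impossible Xx (X₂≡0 b)

  -- The extra dimension is spent on the row of v₁.
  middleBlockCut : ∀ r (X : Vertex → Bool) (X₂ : Fin (n G₂) → Bool) → (∀ a → X (inj₁ a) ≡ true) →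
    (∀ b → X (inj₂ (inj₁ b)) ≡ X₂ b) → (∀ c → X (inj₂ (inj₂ c)) ≡ false) →
    FactorsThrough (adj G₂) X₂ r → FactorsThrough adjΔ X (suc r)
  middleBlockCut r X X₂ X₁≡1 X≡X₂ X₃≡0 (factorization m m≤r C₂ B₂ fac₂) = factorization (suc m) (s≤s m≤r) C B fac
    where
    C : Vertex → Fin (suc m) → Bool
    C (inj₁ a)        = onTriangle (inj₁ a) ∷ᶠ (λ _ → false)
    C (inj₂ (inj₁ b)) = onTriangle (inj₂ (inj₁ b)) ∷ᶠ C₂ b
    C (inj₂ (inj₂ c)) = λ _ → false
    B : Fin (suc m) → Vertex → Bool
    B zero    y               = row₁ y
    B (suc t) (inj₂ (inj₁ b)) = B₂ t b
    B (suc t) _               = false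
    not-both-roots : ∀ b b′ → X₂ b ≡ true → X₂ b′ ≡ false → ⌊ b ≟ v₂ ⌋ ∧ ⌊ b′ ≟ v₂ ⌋ ≡ false
    not-both-roots b b′ X₂b X₂b′ with b ≟ v₂ | b′ ≟ v₂
    ... | yes refl | yes refl = impossible X₂b X₂b′
    ... | yes _    | no  _    = refl
    ... | no  _    | _        = refl
    fac : ∀ x y → X x ≡ true → X y ≡ false → adjΔ x y ≡ sum (λ t → C x t ∧ B t y)
    fac (inj₁ a) (inj₂ z) _ _ =
      sym (trans (cong₂ _xor_ (cong (onTriangle (inj₁ a) ∧_) (row₁-outside z)) (sum-replicate-zero m)) (xor-identityʳ _))
    fac (inj₂ (inj₁ b)) (inj₂ (inj₁ b′)) Xx Xy =
      trans (fac₂ b b′ X₂b X₂b′)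
            (sym (cong (_xor sum (λ t → C₂ b t ∧ B₂ t b′))
                       (trans (cong (onTriangle (inj₂ (inj₁ b)) ∧_) (row₁-outside (inj₁ b′))) (not-both-roots b b′ X₂b X₂b′))))
      where
      X₂b  = trans (sym (X≡X₂ b)) Xx
      X₂b′ = trans (sym (X≡X₂ b′)) Xy
    fac (inj₂ (inj₁ b)) (inj₂ (inj₂ c)) _ _ =
      sym (trans (cong₂ _xor_ (cong (onTriangle (inj₂ (inj₁ b)) ∧_) (row₁-outside (inj₂ c))) (∑-zero _ (λ t → ∧-zeroʳ (C₂ b t))))
                 (xor-identityʳ _))
    fac _               (inj₁ a) _  Xy = impossible (X₁≡1 a) Xy
    fac (inj₂ (inj₂ c)) _        Xx _  = impossible Xx (X₃≡0 c)

  middleBlockCut-pendant : ∀ r (X : Vertex → Bool) (X₂ : Fin (n G₂) → Bool) → (∀ a → X (inj₁ a) ≡ true) →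
    (∀ b → X (inj₂ (inj₁ b)) ≡ X₂ b) → (∀ c → X (inj₂ (inj₂ c)) ≡ false) →
    FactorsThrough (pendantAt G₂ v₂) (pendantCut X₂) r → FactorsThrough adjΔ X (suc r)
  middleBlockCut-pendant r X X₂ X₁≡1 X≡X₂ X₃≡0 (factorization m m≤r C₂ B₂ fac₂) = factorization (suc m) (s≤s m≤r) C B fac
    where
    C : Vertex → Fin (suc m) → Bool
    C (inj₁ a)        = onTriangle (inj₁ a) ∷ᶠ (λ _ → false)
    C (inj₂ (inj₁ b)) = false ∷ᶠ C₂ (inj₁ b)
    C (inj₂ (inj₂ c)) = λ _ → false
    B : Fin (suc m) → Vertex → Bool
    B zero    y               = row₁ y
    B (suc t) (inj₂ (inj₁ b)) = B₂ t (inj₁ b)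
    B (suc t) (inj₂ (inj₂ c)) = onTriangle (inj₂ (inj₂ c)) ∧ B₂ t (inj₂ tt)
    B (suc t) (inj₁ a)        = false
    fac : ∀ x y → X x ≡ true → X y ≡ false → adjΔ x y ≡ sum (λ t → C x t ∧ B t y)
    fac (inj₁ a) (inj₂ z) _ _ =
      sym (trans (cong₂ _xor_ (cong (onTriangle (inj₁ a) ∧_) (row₁-outside z)) (sum-replicate-zero m)) (xor-identityʳ _))
    fac (inj₂ (inj₁ b)) (inj₂ (inj₁ b′)) Xx Xy = fac₂ (inj₁ b) (inj₁ b′) (trans (sym (X≡X₂ b)) Xx) (trans (sym (X≡X₂ b′)) Xy)
    fac (inj₂ (inj₁ b)) (inj₂ (inj₂ c))  Xx _  =
      trans (cong (_∧ onTriangle (inj₂ (inj₂ c))) (fac₂ (inj₁ b) (inj₂ tt) (trans (sym (X≡X₂ b)) Xx) refl))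
            (sym (∑-∧-pull (C₂ (inj₁ b)) (λ t → B₂ t (inj₂ tt)) (onTriangle (inj₂ (inj₂ c)))))
    fac _               (inj₁ a) _  Xy = impossible (X₁≡1 a) Xy
    fac (inj₂ (inj₂ c)) _        Xx _  = impossible Xx (X₃≡0 c)

  module WithPendant (w : Fin (n G₃)) where

    attachedAt : Vertex → Bool
    attachedAt (inj₂ (inj₂ c)) = ⌊ c ≟ w ⌋
    attachedAt _               = false

    adjΔ⁺ : Vertex ⊎ ⊤ → Vertex ⊎ ⊤ → Bool
    adjΔ⁺ = withPendant adjΔ attachedAt

    -- The rows of v₁ and v₂ coincide on the columns available here and share
    -- the extra dimension.
    lastBlockCut-pendant : ∀ r (X : Vertex → Bool) (X₃ : Fin (n G₃) → Bool) → (∀ a → X (inj₁ a) ≡ true) →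
      (∀ b → X (inj₂ (inj₁ b)) ≡ true) → (∀ c → X (inj₂ (inj₂ c)) ≡ X₃ c) →
      FactorsThrough (pendantAt G₃ w) (pendantCut X₃) r → FactorsThrough adjΔ⁺ (pendantCut X) (suc r)
    lastBlockCut-pendant r X X₃ X₁≡1 X₂≡1 X≡X₃ (factorization m m≤r C₃ B₃ fac₃) =
      factorization (suc m) (s≤s m≤r) C B fac
      where
      C : Vertex ⊎ ⊤ → Fin (suc m) → Bool
      C (inj₁ (inj₂ (inj₂ c))) = false ∷ᶠ C₃ (inj₁ c)
      C (inj₁ x)               = onTriangle x ∷ᶠ (λ _ → false)
      C (inj₂ _)               = λ _ → false
      B : Fin (suc m) → Vertex ⊎ ⊤ → Bool
      B zero    (inj₁ (inj₂ (inj₂ c))) = onTriangle (inj₂ (inj₂ c))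
      B zero    _                      = false
      B (suc t) (inj₁ (inj₂ (inj₂ c))) = B₃ t (inj₁ c)
      B (suc t) (inj₂ _)               = B₃ t (inj₂ tt)
      B (suc t) _                      = false
      root-row : ∀ x z → onTriangle x ∧ z ≡ (onTriangle x ∧ z) xor sum (λ (t : Fin m) → false)
      root-row x z = sym (trans (cong ((onTriangle x ∧ z) xor_) (sum-replicate-zero m)) (xor-identityʳ _))
      fac : ∀ x y → pendantCut X x ≡ true → pendantCut X y ≡ false → adjΔ⁺ x y ≡ sum (λ t → C x t ∧ B t y)
      fac (inj₁ (inj₂ (inj₂ c))) (inj₁ (inj₂ (inj₂ c′))) Xx Xy =
        fac₃ (inj₁ c) (inj₁ c′) (trans (sym (X≡X₃ c)) Xx) (trans (sym (X≡X₃ c′)) Xy)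
      fac (inj₁ (inj₂ (inj₂ c))) (inj₂ _) Xx _ = fac₃ (inj₁ c) (inj₂ tt) (trans (sym (X≡X₃ c)) Xx) refl
      fac (inj₁ (inj₁ a))        (inj₁ (inj₂ (inj₂ c))) _ _ = root-row (inj₁ a) (onTriangle (inj₂ (inj₂ c)))
      fac (inj₁ (inj₂ (inj₁ b))) (inj₁ (inj₂ (inj₂ c))) _ _ = root-row (inj₂ (inj₁ b)) (onTriangle (inj₂ (inj₂ c)))
      fac (inj₁ (inj₁ a))        (inj₂ _) _ _ = trans (sym (∧-zeroʳ _)) (root-row (inj₁ a) false)
      fac (inj₁ (inj₂ (inj₁ b))) (inj₂ _) _ _ = trans (sym (∧-zeroʳ _)) (root-row (inj₂ (inj₁ b)) false)
      fac _ (inj₁ (inj₁ a))        _ Xy = impossible (X₁≡1 a) Xy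
      fac _ (inj₁ (inj₂ (inj₁ b))) _ Xy = impossible (X₂≡1 b) Xy

pendantWidth-step : ∀ G₁ G₂ G₃ v₁ v₂ v₃ w r →
  PendantWidthLe G₁ v₁ r → PendantWidthLe G₂ v₂ r → PendantWidthLe G₃ w r →
  PendantWidthLe (deltaComp G₁ G₂ G₃ v₁ v₂ v₃) (join₃ {n G₁} {n G₂} {n G₃} (inj₂ (inj₂ w))) (suc r)
pendantWidth-step G₁ G₂ G₃ v₁ v₂ v₃ w r (π₁ , fac₁) (π₂ , fac₂) (π₃ , fac₃) =
  layout , λ i → FactorsThrough-cong (cut-pullback i) (FactorsThrough-pullback f adj-pullback (blockCut i))
  where
  open Delta G₁ G₂ G₃ v₁ v₂ v₃
  open DeltaCuts G₁ G₂ G₃ v₁ v₂ v₃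
  open WithPendant w
  open Concat π₁ π₂ π₃
  w′ : Fin (n D)
  w′ = join₃ {n G₁} (inj₂ (inj₂ w))
  join₃-inj : Injective _≡_ _≡_ (join₃ {n G₁} {n G₂} {n G₃})
  join₃-inj = join₃-injective
  f : Fin (n D) ⊎ ⊤ → Vertex ⊎ ⊤
  f (inj₁ x) = inj₁ (part x)
  f (inj₂ t) = inj₂ t
  attachedAt-join₃ : ∀ v → attachedAt v ≡ ⌊ join₃ v ≟ w′ ⌋
  attachedAt-join₃ (inj₁ a)        = sym (≢⇒≟-false (λ e → case join₃-inj {inj₁ a} {inj₂ (inj₂ w)} e of λ ()))
  attachedAt-join₃ (inj₂ (inj₁ b)) = sym (≢⇒≟-false (λ e → case join₃-inj {inj₂ (inj₁ b)} {inj₂ (inj₂ w)} e of λ ()))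
  attachedAt-join₃ (inj₂ (inj₂ c)) =
    sym (⌊≟⌋-injective (join₃ {n G₁} ∘ inj₂ ∘ inj₂)
                       (λ {x} {y} e → case join₃-inj {inj₂ (inj₂ x)} {inj₂ (inj₂ y)} e of λ { refl → refl }) c w)
  attachedAt-part : ∀ x → attachedAt (part x) ≡ ⌊ x ≟ w′ ⌋
  attachedAt-part x = trans (attachedAt-join₃ (part x)) (cong (λ z → ⌊ z ≟ w′ ⌋) (join₃∘part {n G₁} {n G₂} {n G₃} x))
  adj-pullback : ∀ x y → adjΔ⁺ (f x) (f y) ≡ pendantAt D w′ x y
  adj-pullback (inj₁ x) (inj₁ y) = sym (adj-part x y)
  adj-pullback (inj₁ x) (inj₂ _) = attachedAt-part x
  adj-pullback (inj₂ _) (inj₁ y) = attachedAt-part y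
  adj-pullback (inj₂ _) (inj₂ _) = refl
  cut-pullback : ∀ i x → pendantCut (cut i) (f x) ≡ pendantCut (prefixᵇ layout i) x
  cut-pullback i (inj₁ x) =
    sym (trans (cong (prefixᵇ layout i) (sym (join₃∘part {n G₁} {n G₂} {n G₃} x))) (prefix-layout i (part x)))
  cut-pullback i (inj₂ _) = refl
  avoids-w : ∀ {i} → (∀ c → cut i (inj₂ (inj₂ c)) ≡ false) → ∀ v → cut i v ≡ true → attachedAt v ≡ false
  avoids-w _     (inj₁ _)        _ = refl
  avoids-w _     (inj₂ (inj₁ _)) _ = refl
  avoids-w X₃≡0 (inj₂ (inj₂ c)) X = ⊥-elim (true≢false (trans (sym X) (X₃≡0 c)))
  blockCut : ∀ i → FactorsThrough adjΔ⁺ (pendantCut (cut i)) (suc r)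
  blockCut i with regime i
  ... | first X₂≡0 X₃≡0 =
    addPendant (avoids-w X₃≡0)
      (FactorsThrough-mono (n≤1+n r) (firstBlockCut r (cut i) (prefixᵇ π₁ i) (λ _ → refl) X₂≡0 X₃≡0 (fac₁ i)))
  ... | second X₁≡1 X≡X₂ X₃≡0 =
    addPendant (avoids-w X₃≡0) (middleBlockCut-pendant r (cut i) (prefixᵇ π₂ (i ∸ n G₁)) X₁≡1 X≡X₂ X₃≡0 (fac₂ (i ∸ n G₁)))
  ... | third X₁≡1 X₂≡1 X≡X₃ =
    lastBlockCut-pendant r (cut i) (prefixᵇ π₃ (i ∸ (n G₁ + n G₂))) X₁≡1 X₂≡1 X≡X₃ (fac₃ (i ∸ (n G₁ + n G₂)))

rotate-≅-first : ∀ A B C u v w (a : Fin (n A)) →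
  proj₁ (rotate-≅ A B C u v w) ⟨$⟩ʳ join₃ {n A} {n B} {n C} (inj₁ a) ≡ join₃ {n B} {n C} {n A} (inj₂ (inj₂ a))
rotate-≅-first A B C u v w a rewrite part∘join₃ {n A} {n B} {n C} (inj₁ a) = refl

swap-≅-second : ∀ A B C u v w (b : Fin (n B)) →
  proj₁ (swap-≅ A B C u v w) ⟨$⟩ʳ join₃ {n A} {n B} {n C} (inj₂ (inj₁ b)) ≡ join₃ {n A} {n C} {n B} (inj₂ (inj₂ b))
swap-≅-second A B C u v w b rewrite part∘join₃ {n A} {n B} {n C} (inj₂ (inj₁ b)) = refl

-- Up to reordering the blocks, every vertex lies in the last block, where
-- pendantWidth-step applies.
InDelta⇒pendantWidth : ∀ {k G} → InDelta k G → ∀ v → PendantWidthLe G v (suc k)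
InDelta⇒pendantWidth {G = G} (base φ) v = pendantWidth-≅ {G} {K2} φ v 1 (pendantWidth-K2 _)
InDelta⇒pendantWidth {suc k} {G} (step H₁ H₂ H₃ u₁ u₂ u₃ d₁ d₂ d₃ φ) v =
  pendantWidth-≅ {G} {D} φ v (suc (suc k))
    (subst (λ z → PendantWidthLe D z (suc (suc k))) (join₃∘part {n H₁} {n H₂} {n H₃} _) (at (part (proj₁ φ ⟨$⟩ʳ v))))
  where
  D = deltaComp H₁ H₂ H₃ u₁ u₂ u₃
  at : ∀ x → PendantWidthLe D (join₃ {n H₁} {n H₂} {n H₃} x) (suc (suc k))
  at (inj₂ (inj₂ c)) = pendantWidth-step H₁ H₂ H₃ u₁ u₂ u₃ c (suc k)
                         (InDelta⇒pendantWidth d₁ u₁) (InDelta⇒pendantWidth d₂ u₂) (InDelta⇒pendantWidth d₃ c)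
  at (inj₁ a) = pendantWidth-≅ {D} {deltaComp H₂ H₃ H₁ u₂ u₃ u₁} (rotate-≅ H₁ H₂ H₃ u₁ u₂ u₃) _ (suc (suc k))
    (subst (λ z → PendantWidthLe (deltaComp H₂ H₃ H₁ u₂ u₃ u₁) z (suc (suc k))) (sym (rotate-≅-first H₁ H₂ H₃ u₁ u₂ u₃ a))
      (pendantWidth-step H₂ H₃ H₁ u₂ u₃ u₁ a (suc k)
        (InDelta⇒pendantWidth d₂ u₂) (InDelta⇒pendantWidth d₃ u₃) (InDelta⇒pendantWidth d₁ a)))
  at (inj₂ (inj₁ b)) = pendantWidth-≅ {D} {deltaComp H₁ H₃ H₂ u₁ u₃ u₂} (swap-≅ H₁ H₂ H₃ u₁ u₂ u₃) _ (suc (suc k))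
    (subst (λ z → PendantWidthLe (deltaComp H₁ H₃ H₂ u₁ u₃ u₂) z (suc (suc k))) (sym (swap-≅-second H₁ H₂ H₃ u₁ u₂ u₃ b))
      (pendantWidth-step H₁ H₃ H₂ u₁ u₃ u₂ b (suc k)
        (InDelta⇒pendantWidth d₁ u₁) (InDelta⇒pendantWidth d₃ u₃) (InDelta⇒pendantWidth d₂ b)))

-- Lay out G₁, then G₃, then G₂ reversed. A cut inside G₁ or G₂ sees the rest of
-- the graph as a pendant at v₁ or v₂; a cut inside G₃ costs one dimension more
-- than in G₃ itself.
deltaComp-lrw≤ : ∀ r G₁ G₂ G₃ v₁ v₂ v₃ → PendantWidthLe G₁ v₁ (suc r) → PendantWidthLe G₂ v₂ (suc r) →
                 LrwLe G₃ r → LrwLe (deltaComp G₁ G₂ G₃ v₁ v₂ v₃) (suc r)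
deltaComp-lrw≤ r G₁ G₂ G₃ v₁ v₂ v₃ (π₁ , fac₁) (π₂ , fac₂) (π₃ , width₃) =
  transportLayout ψ layout , λ i →
    factorsThrough⇒cutRkLe D₀ (prefix D₀ (transportLayout ψ layout) i) (suc r)
      (FactorsThrough-cong (cut-pullback i) (FactorsThrough-pullback g adj-pullback (blockCut i)))
  where
  D₀ = deltaComp G₁ G₂ G₃ v₁ v₂ v₃
  ψ = proj₁ (swap-≅ G₁ G₂ G₃ v₁ v₂ v₃)
  open Delta G₁ G₃ G₂ v₁ v₃ v₂
  open DeltaCuts G₁ G₃ G₂ v₁ v₃ v₂
  open Concat π₁ π₃ (reverseLayout π₂)
  g : Fin (n D₀) → Vertex
  g x = part (ψ ⟨$⟩ʳ x)
  adj-pullback : ∀ x y → adjΔ (g x) (g y) ≡ adj D₀ x y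
  adj-pullback x y = trans (sym (adj-part (ψ ⟨$⟩ʳ x) (ψ ⟨$⟩ʳ y))) (proj₂ (swap-≅ G₁ G₂ G₃ v₁ v₂ v₃) x y)
  cut-pullback : ∀ i x → cut i (g x) ≡ lookup (prefix D₀ (transportLayout ψ layout) i) x
  cut-pullback i x = sym (begin
      lookup (prefix D₀ (transportLayout ψ layout) i) x
    ≡⟨ lookup-prefix D₀ (transportLayout ψ layout) i x ⟩
      prefixᵇ (transportLayout ψ layout) i x
    ≡⟨ prefix-transport ψ layout i x ⟩
      prefixᵇ layout i (ψ ⟨$⟩ʳ x)
    ≡⟨ cong (prefixᵇ layout i) (sym (join₃∘part {n G₁} {n G₃} {n G₂} (ψ ⟨$⟩ʳ x))) ⟩
      prefixᵇ layout i (join₃ (g x))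
    ≡⟨ prefix-layout i (g x) ⟩
      cut i (g x)
    ∎)
    where open ≡-Reasoning
  blockCut : ∀ i → FactorsThrough adjΔ (cut i) (suc r)
  blockCut i with regime i
  ... | first X₂≡0 X₃≡0 = firstBlockCut (suc r) (cut i) (prefixᵇ π₁ i) (λ _ → refl) X₂≡0 X₃≡0 (fac₁ i)
  ... | second X₁≡1 X≡X₂ X₃≡0 =
    middleBlockCut r (cut i) (lookup (prefix G₃ π₃ (i ∸ n G₁))) X₁≡1
      (λ b → trans (X≡X₂ b) (sym (lookup-prefix G₃ π₃ (i ∸ n G₁) b))) X₃≡0
      (cutRkLe⇒factorsThrough G₃ (prefix G₃ π₃ (i ∸ n G₁)) r (width₃ (i ∸ n G₁)))
  ... | third X₁≡1 X₂≡1 X≡X₃ =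
    FactorsThrough-cong complement (FactorsThrough-∁ adjΔ-sym
      (lastBlockCut (suc r) Y (prefixᵇ π₂ j′) (λ _ → refl) (λ _ → refl) (λ _ → refl) (fac₂ j′)))
    where
    j′ : ℕ
    j′ = n G₂ ∸ (i ∸ (n G₁ + n G₃))
    Y : Vertex → Bool
    Y (inj₂ (inj₂ b)) = prefixᵇ π₂ j′ b
    Y _               = false
    complement : ∀ v → not (Y v) ≡ cut i v
    complement (inj₁ a)        = sym (X₁≡1 a)
    complement (inj₂ (inj₁ c)) = sym (X₂≡1 c)
    complement (inj₂ (inj₂ b)) = sym (trans (X≡X₃ b) (prefix-reverse π₂ _ b))

lemma3p6 : (k : ℕ) (G₁ G₂ G₃ : Graph) →
           InDelta k G₁ → InDelta k G₂ → LrwLe G₃ k →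
           (v₁ : Fin (n G₁)) (v₂ : Fin (n G₂)) (v₃ : Fin (n G₃)) →
           LrwEq (deltaComp G₁ G₂ G₃ v₁ v₂ v₃) (suc k)
lemma3p6 k G₁ G₂ G₃ d₁ d₂ lrw₃ v₁ v₂ v₃ =
  deltaComp-lrw≤ k G₁ G₂ G₃ v₁ v₂ v₃ (InDelta⇒pendantWidth d₁ v₁) (InDelta⇒pendantWidth d₂ v₂) lrw₃ ,
  deltaComp-lrw≥ G₁ G₂ G₃ v₁ v₂ v₃ d₁
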